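{- Let $q$ be a prime power and let $\ell,m,m',n,s \geq 0$ be integers such that $s \leq \min(m, m')$, $\ell \leq m$, and $n \leq m'$, and let $\bm{M} \in \mathbb{F}_q^{m \times m', s}$. Let $(\bm{A}, \bm{B})$ be uniformly random in $\mathbb{F}_q^{\ell \times m, \ell} \times \mathbb{F}_q^{m' \times n, n}$. Then (i) $\mathbb{P}[\bm{A}\bm{M} = \bm{0}] = \prod_{i = 0}^{\ell - 1} \frac{q^{m - s} - q^i}{q^{m} - q^i}$; (ii) $\mathbb{P}[\bm{M}\bm{B} = \bm{0}] = \prod_{i = 0}^{n - 1} \frac{q^{m' - s} - q^i}{q^{m'} - q^i}$; (iii) $\mathbb{P}[\bm{A}\bm{M}\bm{B} = \bm{0}] = \sum_{r = 0}^{\min(\ell, s)} \frac{|\mathbb{F}_q^{\ell \times s, r}| \, |\mathbb{F}_q^{(\ell-r) \times (m-s), \ell - r}| \, q^{(m-s) r}}{|\mathbb{F}_q^{\ell \times m, \ell}|} \prod_{i = 0}^{n - 1} \frac{q^{m' - r} - q^i}{q^{m'} - q^i}$.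
   Context: $\mathbb{F}_q$ is the finite field with $q$ elements. For integers $a,b,r\ge0$, $\mathbb{F}_q^{a \times b, r}$ denotes the set of $a\times b$ matrices over $\mathbb{F}_q$ of rank exactly $r$ (matrices with zero rows or columns are allowed). Empty products equal $1$. -}

module Defs where

open import Data.Bool using (Bool; true; false; _∧_; _∨_; not; if_then_else_)
open import Data.Nat as ℕ using (ℕ; zero; suc; _⊔_; _≡ᵇ_)
open import Data.Fin using (Fin)
open import Data.Integer as ℤ using (ℤ; +_)
open import Data.Rational as ℚ using (ℚ; 0ℚ; 1ℚ)
open import Data.List using (List; []; _∷_; map; concatMap; length; filterᵇ; foldr; upTo; allFin; cartesianProduct)
open import Data.List.Membership.Propositional using (_∈_)
open import Data.List.Relation.Unary.Unique.Propositional using (Unique)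
open import Data.Product using (_×_; _,_; ∃)
open import Data.Vec.Functional as VF using ()
open import Relation.Nullary using (¬_; does)
open import Relation.Binary.PropositionalEquality using (_≡_)
open import Relation.Binary.Definitions using (DecidableEquality)
open import Algebra.Structures using (IsCommutativeRing)

-- Its order q = length elems is then automatically a prime power.

record FiniteField : Set₁ where
  field
    F          : Set
    _+_ _*_    : F → F → F
    -_         : F → F
    0# 1#      : F
    isCommutativeRing : IsCommutativeRing _≡_ _+_ _*_ -_ 0# 1#
    0≢1        : ¬ (0# ≡ 1#)
    inverse    : ∀ x → ¬ (x ≡ 0#) → ∃ λ y → x * y ≡ 1#
    _≟_        : DecidableEquality F
    elems      : List F
    complete   : ∀ x → x ∈ elems
    unique     : Unique elems

  card : ℕ
  card = length elems

allFuns : ∀ {A : Set} → List A → (n : ℕ) → List (Fin n → A)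
allFuns xs zero    = (λ ()) ∷ []
allFuns xs (suc n) = concatMap (λ x → map (λ v → x VF.∷ v) (allFuns xs n)) xs

allᵇ : (n : ℕ) → (Fin n → Bool) → Bool
allᵇ zero    p = true
allᵇ (suc n) p = p Data.Fin.zero ∧ allᵇ n (λ i → p (Data.Fin.suc i))

anyᵇ : ∀ {A : Set} → List A → (A → Bool) → Bool
anyᵇ []       p = false
anyᵇ (x ∷ xs) p = p x ∨ anyᵇ xs p

allListᵇ : ∀ {A : Set} → List A → (A → Bool) → Bool
allListᵇ []       p = true
allListᵇ (x ∷ xs) p = p x ∧ allListᵇ xs p

count : ∀ {A : Set} → List A → (A → Bool) → ℕ
count xs p = length (filterᵇ p xs)

-- the rational number a / d (convention: value 0 if d = 0; never used
-- with d = 0 in the statement)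
frac : ℤ → ℕ → ℚ
frac a zero    = 0ℚ
frac a (suc d) = a ℚ./ suc d

-- uniform probability of an event on a finite sample space given as a
-- duplicate-free list: |{x ∈ Ω | E x}| / |Ω|
prob : ∀ {A : Set} → List A → (A → Bool) → ℚ
prob Ω E = frac (+ count Ω E) (length Ω)

prodQ : ℕ → (ℕ → ℚ) → ℚ
prodQ zero    f = 1ℚ
prodQ (suc n) f = prodQ n f ℚ.* f n

sumQ≤ : ℕ → (ℕ → ℚ) → ℚ
sumQ≤ zero    f = f zero
sumQ≤ (suc n) f = sumQ≤ n f ℚ.+ f (suc n)

module FF (K : FiniteField) where
  open FiniteField K

  Mat : ℕ → ℕ → Set
  Mat a b = Fin a → Fin b → F

  ∑ : (k : ℕ) → (Fin k → F) → F
  ∑ zero    f = 0#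
  ∑ (suc k) f = f Data.Fin.zero + ∑ k (λ i → f (Data.Fin.suc i))

  _⊗_ : ∀ {a k b} → Mat a k → Mat k b → Mat a b
  _⊗_ {k = k} A B i j = ∑ k (λ t → A i t * B t j)

  isZeroᵇ : F → Bool
  isZeroᵇ x = does (x ≟ 0#)

  isZeroVecᵇ : ∀ {a} → (Fin a → F) → Bool
  isZeroVecᵇ {a} v = allᵇ a (λ i → isZeroᵇ (v i))

  isZeroMatᵇ : ∀ {a b} → Mat a b → Bool
  isZeroMatᵇ {a} {b} M = allᵇ a (λ i → allᵇ b (λ j → isZeroᵇ (M i j)))

  linIndepᵇ : ∀ {a} (k : ℕ) → (Fin k → (Fin a → F)) → Bool
  linIndepᵇ k v =
    allListᵇ (allFuns elems k) λ c →
      not (isZeroVecᵇ (λ i → ∑ k (λ j → c j * v j i))) ∨ isZeroVecᵇ c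

  hasIndepColsᵇ : ∀ {a b} → Mat a b → ℕ → Bool
  hasIndepColsᵇ {a} {b} M k =
    anyᵇ (allFuns (allFin b) k) λ σ → linIndepᵇ k (λ j i → M i (σ j))

  rank : ∀ {a b} → Mat a b → ℕ
  rank {a} {b} M =
    foldr _⊔_ 0 (map (λ k → if hasIndepColsᵇ M k then k else 0) (upTo (suc b)))

  allMats : (a b : ℕ) → List (Mat a b)
  allMats a b = allFuns (allFuns elems b) a

  MatsOfRank : (a b r : ℕ) → List (Mat a b)
  MatsOfRank a b r = filterᵇ (λ M → rank M ≡ᵇ r) (allMats a b)

  #Rank : (a b r : ℕ) → ℕ
  #Rank a b r = length (MatsOfRank a b r)

  Pairs : (ℓ m m' n : ℕ) → List (Mat ℓ m × Mat m' n)
  Pairs ℓ m m' n = cartesianProduct (MatsOfRank ℓ m ℓ) (MatsOfRank m' n n)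

  q : ℕ
  q = card

  ratioFactor : (e d i : ℕ) → ℚ
  ratioFactor e d i = frac (+ (q ℕ.^ e) ℤ.- + (q ℕ.^ i)) (q ℕ.^ d ℕ.∸ q ℕ.^ i)

{-# OPTIONS --safe #-}
module Submission where

-- Every probability is a ratio of counts, and every count is computed by adding matrix columns
-- one at a time. Over a field with q elements a matrix Y with b columns satisfies
-- #im Y * #ker Y = q ^ b and q ^ rank Y = #im Y, and counting the pairs (x , y) with
-- y ∙ (Y · x) = 0 in two ways gives rank (Y ᵀ) = rank Y. Appending a column v to C keeps the image
-- when v ∈ im C and multiplies its size by q otherwise. This yields a recursion in ℓ for the number
-- #FullRank⊗ Y ℓ r of full-rank b × ℓ matrices C with rank (Y ⊗ C) = r, whose solution is
-- #Rank s ℓ r * #frames d (ℓ - r) * q ^ (d * r) with s = rank Y, d = b - s and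
-- #frames d k = ∏_{i < k} (q ^ d - q ^ i). Taking Y = M for B and, through A ↦ Aᵀ, Y = Mᵀ for A
-- gives (ii) and (i) (the case r = 0); (iii) follows by splitting the count according to rank (A ⊗ M).

open import Defs

open import Level using (Level; 0ℓ)
open import Algebra.Bundles using (CommutativeRing)
open import Algebra.Structures using (IsCommutativeRing)
open import Data.Bool using (Bool; true; false; not; _∧_; _∨_; if_then_else_; T)
open import Data.Bool.Properties using (T-∧; T-∨)
open import Data.Empty using (⊥-elim)
open import Data.Fin using (Fin; zero; suc)
import Data.Fin.Properties as Finₚ
open import Data.Integer as ℤ using ()
import Data.Integer.Properties as ℤₚ
open import Data.Integer.Tactic.RingSolver using () renaming (solve-∀ to ℤ-solve-∀)
open import Data.List using (List; []; _∷_; _++_; map; concatMap; length; filterᵇ; cartesianProduct; foldr; upTo; allFin)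
open import Data.List.Membership.Propositional using (_∈_)
open import Data.List.Membership.Propositional.Properties using (∈-allFin; ∈-upTo⁺; ∈-upTo⁻; ∈-map⁻; foldr-selective)
open import Data.List.Properties using (map-cong; map-++; map-∘)
import Data.List.Relation.Unary.All as All
open import Data.List.Relation.Unary.All using (All; []; _∷_)
open import Data.List.Relation.Unary.All.Properties using (All¬⇒¬Any)
open import Data.List.Relation.Unary.AllPairs using (_∷_)
open import Data.List.Relation.Unary.Any as Any using (Any; here; there; any?)
open import Data.List.Relation.Unary.Unique.Propositional using (Unique)
open import Data.List.Relation.Unary.Unique.Propositional.Properties using (allFin⁺)
open import Data.Nat as ℕ using (ℕ; zero; suc; _+_; _*_; _∸_; _^_; _≤_; _<_; _⊓_; _⊔_; z≤n; s≤s)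
open import Data.Nat.ListAction using (sum)
open import Data.Nat.ListAction.Properties using (sum-++)
import Data.Nat.Properties as ℕₚ
open import Data.Nat.Tactic.RingSolver using (solve-∀)
open import Data.Product using (_×_; _,_; proj₁; proj₂; ∃-syntax)
import Data.Product.Relation.Binary.Pointwise.NonDependent as ×
import Data.Rational as ℚ
import Data.Rational.Properties as ℚₚ
import Data.Rational.Unnormalised as ℚᵘ
import Data.Rational.Unnormalised.Properties as ℚᵘₚ
open import Data.Sum using (inj₁; inj₂; [_,_]′)
open import Data.Unit using (tt)
open import Data.Vec.Functional as Vector using (Vector)
import Data.Vec.Functional.Relation.Binary.Pointwise.Properties as Pointwise
open import Function using (_∘_; _⇔_; mk⇔; Congruent; Equivalence)
open Equivalence using (to; from)
open import Relation.Binary.Bundles using (DecSetoid)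
open import Relation.Binary.Definitions using (DecidableEquality; tri<; tri≈; tri>)
open import Relation.Binary.PropositionalEquality
open import Relation.Binary.PropositionalEquality.Properties as ≡ using ()
open import Relation.Nullary using (¬_; Dec; yes; no; does)
open import Relation.Nullary.Decidable using (does-⇔; dec-true; dec-false; map′; T?)

import Algebra.Properties.CommutativeSemigroup ℕₚ.+-commutativeSemigroup as ℕ+
import Algebra.Properties.CommutativeSemigroup ℕₚ.*-commutativeSemigroup as ℕ*

private variable
  α β γ ℓ₁ ℓ₂ : Level
  A B : Set α

⟦_⟧ : Bool → ℕ
⟦ true ⟧  = 1
⟦ false ⟧ = 0

⟦∧⟧ : ∀ x y → ⟦ x ∧ y ⟧ ≡ ⟦ x ⟧ * ⟦ y ⟧
⟦∧⟧ true  y = sym (ℕₚ.+-identityʳ ⟦ y ⟧)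
⟦∧⟧ false y = refl

⟦⟧≤1 : ∀ x → ⟦ x ⟧ ≤ 1
⟦⟧≤1 true  = ℕₚ.≤-refl
⟦⟧≤1 false = z≤n

⟦does⟧-mono : ∀ {P : Set α} {Q : Set β} (P? : Dec P) (Q? : Dec Q) → (P → Q) → ⟦ does P? ⟧ ≤ ⟦ does Q? ⟧
⟦does⟧-mono (no _)  _       _   = z≤n
⟦does⟧-mono (yes _) (yes _) _   = ℕₚ.≤-refl
⟦does⟧-mono (yes p) (no ¬q) p⇒q = ⊥-elim (¬q (p⇒q p))

T-does : ∀ {P : Set α} (P? : Dec P) → T (does P?) ⇔ P
T-does (yes p)  = mk⇔ (λ _ → p) (λ _ → tt)
T-does (no ¬p)  = mk⇔ (λ ()) ¬p

T-not-∨ : ∀ x y → T (not x ∨ y) ⇔ (T x → T y)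
T-not-∨ true  y = mk⇔ (λ ty _ → ty) (λ f → f tt)
T-not-∨ false y = mk⇔ (λ _ ()) (λ _ → tt)

T-allᵇ : ∀ n (p : Fin n → Bool) → T (allᵇ n p) ⇔ (∀ i → T (p i))
T-allᵇ zero    p = mk⇔ (λ _ ()) (λ _ → tt)
T-allᵇ (suc n) p = mk⇔
  (λ t → let (t₀ , tₛ) = to T-∧ t in λ { zero → t₀ ; (suc i) → to (T-allᵇ n (p ∘ suc)) tₛ i })
  (λ h → from T-∧ (h zero , from (T-allᵇ n (p ∘ suc)) (h ∘ suc)))

T-allListᵇ : ∀ (xs : List A) p → T (allListᵇ xs p) ⇔ All (T ∘ p) xs
T-allListᵇ []       p = mk⇔ (λ _ → []) (λ _ → tt)
T-allListᵇ (x ∷ xs) p = mk⇔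
  (λ t → let (tₓ , tₛ) = to T-∧ t in tₓ ∷ to (T-allListᵇ xs p) tₛ)
  (λ { (tₓ ∷ tₛ) → from T-∧ (tₓ , from (T-allListᵇ xs p) tₛ) })

T-anyᵇ : ∀ (xs : List A) p → T (anyᵇ xs p) ⇔ Any (T ∘ p) xs
T-anyᵇ []       p = mk⇔ (λ ()) (λ ())
T-anyᵇ (x ∷ xs) p = mk⇔
  (λ t → [ here , there ∘ to (T-anyᵇ xs p) ]′ (to T-∨ t))
  (λ { (here tₓ) → from T-∨ (inj₁ tₓ) ; (there tₛ) → from T-∨ (inj₂ (from (T-anyᵇ xs p) tₛ)) })

T⇔⇒≡does : ∀ {x} {P : Set α} → T x ⇔ P → (P? : Dec P) → x ≡ does P?
T⇔⇒≡does {x = x} Tx⇔P P? = does-⇔ Tx⇔P (T? x) P?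

sumMap : List A → (A → ℕ) → ℕ
sumMap xs f = sum (map f xs)

sumMap-cong : ∀ (xs : List A) {f g : A → ℕ} → f ≗ g → sumMap xs f ≡ sumMap xs g
sumMap-cong xs f≗g = cong sum (map-cong f≗g xs)

sumMap-mono-≤ : ∀ (xs : List A) {f g : A → ℕ} → (∀ x → f x ≤ g x) → sumMap xs f ≤ sumMap xs g
sumMap-mono-≤ []       f≤g = z≤n
sumMap-mono-≤ (x ∷ xs) f≤g = ℕₚ.+-mono-≤ (f≤g x) (sumMap-mono-≤ xs f≤g)

sumMap-zero : ∀ (xs : List A) → sumMap xs (λ _ → 0) ≡ 0
sumMap-zero []       = refl
sumMap-zero (x ∷ xs) = sumMap-zero xs

sumMap-const : ∀ (xs : List A) c → sumMap xs (λ _ → c) ≡ c * length xs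
sumMap-const []       c = sym (ℕₚ.*-zeroʳ c)
sumMap-const (x ∷ xs) c = trans (cong (c +_) (sumMap-const xs c)) (sym (ℕₚ.*-suc c (length xs)))

length≡sumMap : ∀ (xs : List A) → length xs ≡ sumMap xs (λ _ → 1)
length≡sumMap xs = sym (trans (sumMap-const xs 1) (ℕₚ.*-identityˡ (length xs)))

sumMap-+ : ∀ (xs : List A) f g → sumMap xs (λ x → f x + g x) ≡ sumMap xs f + sumMap xs g
sumMap-+ []       f g = refl
sumMap-+ (x ∷ xs) f g = trans (cong (f x + g x +_) (sumMap-+ xs f g))
                              (ℕ+.interchange (f x) (g x) (sumMap xs f) (sumMap xs g))

sumMap-∸ : ∀ (xs : List A) f g → (∀ x → g x ≤ f x) →
           sumMap xs (λ x → f x ∸ g x) ≡ sumMap xs f ∸ sumMap xs g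
sumMap-∸ xs f g g≤f = begin
  sumMap xs (λ x → f x ∸ g x)
    ≡⟨ ℕₚ.m+n∸n≡m _ (sumMap xs g) ⟨
  sumMap xs (λ x → f x ∸ g x) + sumMap xs g ∸ sumMap xs g
    ≡⟨ cong (_∸ sumMap xs g) (sym (sumMap-+ xs _ g)) ⟩
  sumMap xs (λ x → f x ∸ g x + g x) ∸ sumMap xs g
    ≡⟨ cong (_∸ sumMap xs g) (sumMap-cong xs (λ x → ℕₚ.m∸n+n≡m (g≤f x))) ⟩
  sumMap xs f ∸ sumMap xs g ∎
  where open ≡-Reasoning

sumMap-*ˡ : ∀ (xs : List A) c f → sumMap xs (λ x → c * f x) ≡ c * sumMap xs f
sumMap-*ˡ []       c f = sym (ℕₚ.*-zeroʳ c)
sumMap-*ˡ (x ∷ xs) c f = trans (cong (c * f x +_) (sumMap-*ˡ xs c f)) (sym (ℕₚ.*-distribˡ-+ c (f x) _))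

sumMap-*ʳ : ∀ (xs : List A) c f → sumMap xs (λ x → f x * c) ≡ sumMap xs f * c
sumMap-*ʳ xs c f = trans (sumMap-cong xs (λ x → ℕₚ.*-comm (f x) c))
                         (trans (sumMap-*ˡ xs c f) (ℕₚ.*-comm c (sumMap xs f)))

sumMap-swap : ∀ (xs : List A) (ys : List B) (f : A → B → ℕ) →
              sumMap xs (λ x → sumMap ys (f x)) ≡ sumMap ys (λ y → sumMap xs (λ x → f x y))
sumMap-swap []       ys f = sym (sumMap-zero ys)
sumMap-swap (x ∷ xs) ys f =
  trans (cong (sumMap ys (f x) +_) (sumMap-swap xs ys f)) (sym (sumMap-+ ys (f x) _))

sumMap-++ : ∀ (xs ys : List A) f → sumMap (xs ++ ys) f ≡ sumMap xs f + sumMap ys f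
sumMap-++ xs ys f = trans (cong sum (map-++ f xs ys)) (sum-++ (map f xs) (map f ys))

sumMap-map : ∀ (g : A → B) xs f → sumMap (map g xs) f ≡ sumMap xs (f ∘ g)
sumMap-map g xs f = cong sum (sym (map-∘ xs))

sumMap-concatMap : ∀ (g : A → List B) xs f → sumMap (concatMap g xs) f ≡ sumMap xs (λ x → sumMap (g x) f)
sumMap-concatMap g []       f = refl
sumMap-concatMap g (x ∷ xs) f =
  trans (sumMap-++ (g x) (concatMap g xs) f) (cong (sumMap (g x) f +_) (sumMap-concatMap g xs f))

sumMap-cartesianProduct : ∀ (xs : List A) (ys : List B) f →
  sumMap (cartesianProduct xs ys) f ≡ sumMap xs (λ x → sumMap ys (λ y → f (x , y)))
sumMap-cartesianProduct []       ys f = refl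
sumMap-cartesianProduct (x ∷ xs) ys f =
  trans (sumMap-++ (map (x ,_) ys) _ f)
        (cong₂ _+_ (sumMap-map (x ,_) ys f) (sumMap-cartesianProduct xs ys f))

sumMap-filterᵇ : ∀ (p : A → Bool) xs f → sumMap (filterᵇ p xs) f ≡ sumMap xs (λ x → ⟦ p x ⟧ * f x)
sumMap-filterᵇ p []       f = refl
sumMap-filterᵇ p (x ∷ xs) f with p x
... | true  = cong₂ _+_ (sym (ℕₚ.+-identityʳ (f x))) (sumMap-filterᵇ p xs f)
... | false = sumMap-filterᵇ p xs f

count≡sumMap : ∀ (xs : List A) p → count xs p ≡ sumMap xs (λ x → ⟦ p x ⟧)
count≡sumMap xs p = begin
  length (filterᵇ p xs)                  ≡⟨ length≡sumMap (filterᵇ p xs) ⟩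
  sumMap (filterᵇ p xs) (λ _ → 1)        ≡⟨ sumMap-filterᵇ p xs _ ⟩
  sumMap xs (λ x → ⟦ p x ⟧ * 1)          ≡⟨ sumMap-cong xs (λ x → ℕₚ.*-identityʳ ⟦ p x ⟧) ⟩
  sumMap xs (λ x → ⟦ p x ⟧)              ∎
  where open ≡-Reasoning

sumMap-nested-split : ∀ (xs : List A) (u w f : A → ℕ) m n →
  (∀ x → u x ≤ w x) → (∀ x → w x ≤ 1) → (∀ x → f x ≡ (w x ∸ u x) * m + (1 ∸ w x) * n) →
  sumMap xs f ≡ (sumMap xs w ∸ sumMap xs u) * m + (length xs ∸ sumMap xs w) * n
sumMap-nested-split xs u w f m n u≤w w≤1 f≡ = begin
  sumMap xs f
    ≡⟨ sumMap-cong xs f≡ ⟩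
  sumMap xs (λ x → (w x ∸ u x) * m + (1 ∸ w x) * n)
    ≡⟨ sumMap-+ xs _ _ ⟩
  sumMap xs (λ x → (w x ∸ u x) * m) + sumMap xs (λ x → (1 ∸ w x) * n)
    ≡⟨ cong₂ _+_ (sumMap-*ʳ xs m _) (sumMap-*ʳ xs n _) ⟩
  sumMap xs (λ x → w x ∸ u x) * m + sumMap xs (λ x → 1 ∸ w x) * n
    ≡⟨ cong₂ (λ s t → s * m + t * n) (sumMap-∸ xs w u u≤w) (sumMap-∸ xs (λ _ → 1) w w≤1) ⟩
  (sumMap xs w ∸ sumMap xs u) * m + (sumMap xs (λ _ → 1) ∸ sumMap xs w) * n
    ≡⟨ cong (λ l → (sumMap xs w ∸ sumMap xs u) * m + (l ∸ sumMap xs w) * n) (length≡sumMap xs) ⟨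
  (sumMap xs w ∸ sumMap xs u) * m + (length xs ∸ sumMap xs w) * n ∎
  where open ≡-Reasoning

sumMap-positive⇒any : ∀ (xs : List A) f → 0 < sumMap xs f → Any (λ x → 0 < f x) xs
sumMap-positive⇒any (x ∷ xs) f pos with f x in fx≡
... | suc _ = here (subst (0 <_) (sym fx≡) (s≤s z≤n))
... | zero  = there (sumMap-positive⇒any xs f pos)

sumMap-allFuns-suc : ∀ (xs : List A) n f →
  sumMap (allFuns xs (suc n)) f ≡ sumMap xs (λ x → sumMap (allFuns xs n) (λ v → f (x Vector.∷ v)))
sumMap-allFuns-suc xs n f = trans (sumMap-concatMap (λ x → map (x Vector.∷_) (allFuns xs n)) xs f)
                                  (sumMap-cong xs (λ x → sumMap-map (x Vector.∷_) (allFuns xs n) f))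

length-allFuns : ∀ (xs : List A) n → length (allFuns xs n) ≡ length xs ^ n
length-allFuns xs zero    = refl
length-allFuns xs (suc n) = begin
  length (allFuns xs (suc n))                           ≡⟨ length≡sumMap (allFuns xs (suc n)) ⟩
  sumMap (allFuns xs (suc n)) (λ _ → 1)                 ≡⟨ sumMap-allFuns-suc xs n _ ⟩
  sumMap xs (λ _ → sumMap (allFuns xs n) (λ _ → 1))     ≡⟨ sumMap-cong xs (λ _ → length≡sumMap (allFuns xs n)) ⟨
  sumMap xs (λ _ → length (allFuns xs n))               ≡⟨ cong (λ l → sumMap xs (λ _ → l)) (length-allFuns xs n) ⟩
  sumMap xs (λ _ → length xs ^ n)                       ≡⟨ sumMap-const xs _ ⟩
  length xs ^ n * length xs                             ≡⟨ ℕₚ.*-comm (length xs ^ n) (length xs) ⟩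
  length xs ^ suc n                                     ∎
  where open ≡-Reasoning

∈⇒1≤length : ∀ {x : A} {xs} → x ∈ xs → 1 ≤ length xs
∈⇒1≤length (here _)  = s≤s z≤n
∈⇒1≤length (there _) = s≤s z≤n

distinct-∈⇒2≤length : ∀ {x y : A} {xs} → Unique xs → x ∈ xs → y ∈ xs → x ≢ y → 2 ≤ length xs
distinct-∈⇒2≤length _        (here x≡z)  (here y≡z)  x≢y = ⊥-elim (x≢y (trans x≡z (sym y≡z)))
distinct-∈⇒2≤length _        (here _)    (there y∈)  _   = s≤s (∈⇒1≤length y∈)
distinct-∈⇒2≤length _        (there x∈)  (here _)    _   = s≤s (∈⇒1≤length x∈)
distinct-∈⇒2≤length (_ ∷ u) (there x∈)  (there y∈)  x≢y =
  ℕₚ.m≤n⇒m≤1+n (distinct-∈⇒2≤length u x∈ y∈ x≢y)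

⊔-foldr-ub : ∀ (f : A → ℕ) {x xs} → x ∈ xs → f x ≤ foldr _⊔_ 0 (map f xs)
⊔-foldr-ub f (here refl)  = ℕₚ.m≤m⊔n (f _) _
⊔-foldr-ub f (there x∈xs) = ℕₚ.m≤n⇒m≤o⊔n (f _) (⊔-foldr-ub f x∈xs)

⊔-foldr-lub : ∀ (f : A → ℕ) xs {m} → (∀ {x} → x ∈ xs → f x ≤ m) → foldr _⊔_ 0 (map f xs) ≤ m
⊔-foldr-lub f []       f≤m = z≤n
⊔-foldr-lub f (x ∷ xs) f≤m = ℕₚ.⊔-lub (f≤m (here refl)) (⊔-foldr-lub f xs (f≤m ∘ there))

-- Enumerations of decidable setoids

module Enumeration (D : DecSetoid γ ℓ₁) where
  open DecSetoid D renaming (refl to ≈-refl; sym to ≈-sym; trans to ≈-trans)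

  δ : Carrier → Carrier → ℕ
  δ x y = ⟦ does (x ≟ y) ⟧

  Enumerates : List Carrier → Set γ
  Enumerates xs = ∀ x → sumMap xs (δ x) ≡ 1

  δ-yes : ∀ {x y} → x ≈ y → δ x y ≡ 1
  δ-yes {x} {y} x≈y with x ≟ y
  ... | yes _   = refl
  ... | no x≉y = ⊥-elim (x≉y x≈y)

  δ-no : ∀ {x y} → ¬ x ≈ y → δ x y ≡ 0
  δ-no {x} {y} x≉y with x ≟ y
  ... | yes x≈y = ⊥-elim (x≉y x≈y)
  ... | no _    = refl

  δ≤1 : ∀ x y → δ x y ≤ 1
  δ≤1 x y = ⟦⟧≤1 (does (x ≟ y))

  δ-positive : ∀ {x y} → 0 < δ x y → x ≈ y
  δ-positive {x} {y} pos with x ≟ y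
  ... | yes x≈y = x≈y

  δ-sym : ∀ x y → δ x y ≡ δ y x
  δ-sym x y = cong ⟦_⟧ (does-⇔ (mk⇔ ≈-sym ≈-sym) (x ≟ y) (y ≟ x))

  δ-congʳ : ∀ x {y z} → y ≈ z → δ x y ≡ δ x z
  δ-congʳ x {y} {z} y≈z =
    cong ⟦_⟧ (does-⇔ (mk⇔ (λ p → ≈-trans p y≈z) (λ p → ≈-trans p (≈-sym y≈z))) (x ≟ y) (x ≟ z))

  δ*-subst : ∀ (f : Carrier → ℕ) → Congruent _≈_ _≡_ f → ∀ x y → δ x y * f x ≡ δ x y * f y
  δ*-subst f f-cong x y with x ≟ y
  ... | yes x≈y = cong (1 *_) (f-cong x≈y)
  ... | no _    = refl

  module _ (xs : List Carrier) (enum : Enumerates xs) where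

    sumMap-δ : ∀ f → Congruent _≈_ _≡_ f → ∀ x → sumMap xs (λ y → δ x y * f y) ≡ f x
    sumMap-δ f f-cong x = begin
      sumMap xs (λ y → δ x y * f y) ≡⟨ sumMap-cong xs (λ y → δ*-subst f f-cong x y) ⟨
      sumMap xs (λ y → δ x y * f x) ≡⟨ sumMap-*ʳ xs (f x) (δ x) ⟩
      sumMap xs (δ x) * f x         ≡⟨ cong (_* f x) (enum x) ⟩
      1 * f x                       ≡⟨ ℕₚ.*-identityˡ (f x) ⟩
      f x                           ∎
      where open ≡-Reasoning

    ≤-sumMap : ∀ f → Congruent _≈_ _≡_ f → ∀ x → f x ≤ sumMap xs f
    ≤-sumMap f f-cong x = subst (_≤ sumMap xs f) (sumMap-δ f f-cong x) (sumMap-mono-≤ xs δ*f≤f)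
      where
      δ*f≤f : ∀ y → δ x y * f y ≤ f y
      δ*f≤f y = ℕₚ.≤-trans (ℕₚ.*-monoˡ-≤ (f y) (δ≤1 x y)) (ℕₚ.≤-reflexive (ℕₚ.*-identityˡ (f y)))

    2≤sumMap : ∀ f → Congruent _≈_ _≡_ f → ∀ {u v} → ¬ u ≈ v → 1 ≤ f u → 1 ≤ f v → 2 ≤ sumMap xs f
    2≤sumMap f f-cong {u} {v} u≉v 1≤fu 1≤fv = begin
      2
        ≤⟨ ℕₚ.+-mono-≤ 1≤fu 1≤fv ⟩
      f u + f v
        ≡⟨ cong₂ _+_ (sumMap-δ f f-cong u) (sumMap-δ f f-cong v) ⟨
      sumMap xs (λ y → δ u y * f y) + sumMap xs (λ y → δ v y * f y)
        ≡⟨ sumMap-+ xs _ _ ⟨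
      sumMap xs (λ y → δ u y * f y + δ v y * f y)
        ≤⟨ sumMap-mono-≤ xs δδ*f≤f ⟩
      sumMap xs f ∎
      where
      open ℕₚ.≤-Reasoning
      δδ*f≤f : ∀ y → δ u y * f y + δ v y * f y ≤ f y
      δδ*f≤f y with u ≟ y | v ≟ y
      ... | yes u≈y | yes v≈y = ⊥-elim (u≉v (≈-trans u≈y (≈-sym v≈y)))
      ... | yes _   | no _    = ℕₚ.≤-reflexive (trans (ℕₚ.+-identityʳ _) (ℕₚ.+-identityʳ (f y)))
      ... | no _    | yes _   = ℕₚ.≤-reflexive (ℕₚ.+-identityʳ (f y))
      ... | no _    | no _    = z≤n

    enumerates⇒any : ∀ x → Any (x ≈_) xs
    enumerates⇒any x = Any.map δ-positive
      (sumMap-positive⇒any xs (δ x) (ℕₚ.≤-reflexive (sym (enum x))))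

  -- Insert 1 = Σ_y δ x y under the sum and swap the two sums.
  sumMap-enumeration-invariant : ∀ {xs ys} → Enumerates xs → Enumerates ys →
    ∀ f → Congruent _≈_ _≡_ f → sumMap xs f ≡ sumMap ys f
  sumMap-enumeration-invariant {xs} {ys} enum-xs enum-ys f f-cong = begin
    sumMap xs f
      ≡⟨ sumMap-cong xs (sumMap-δ ys enum-ys f f-cong) ⟨
    sumMap xs (λ x → sumMap ys (λ y → δ x y * f y))
      ≡⟨ sumMap-swap xs ys _ ⟩
    sumMap ys (λ y → sumMap xs (λ x → δ x y * f y))
      ≡⟨ sumMap-cong ys (λ y → sumMap-cong xs (λ x → cong (_* f y) (δ-sym x y))) ⟩
    sumMap ys (λ y → sumMap xs (λ x → δ y x * f y))
      ≡⟨ sumMap-cong ys (λ y → sumMap-*ʳ xs (f y) (δ y)) ⟩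
    sumMap ys (λ y → sumMap xs (δ y) * f y)
      ≡⟨ sumMap-cong ys (λ y → trans (cong (_* f y) (enum-xs y)) (ℕₚ.*-identityˡ (f y))) ⟩
    sumMap ys f ∎
    where open ≡-Reasoning

open Enumeration

module _ (D : DecSetoid α ℓ₁) (E : DecSetoid β ℓ₂) where
  private
    module D = DecSetoid D
    module E = DecSetoid E

  δ-⇔ : ∀ {x y u v} → x D.≈ y ⇔ u E.≈ v → δ D x y ≡ δ E u v
  δ-⇔ {x} {y} {u} {v} x≈y⇔u≈v = cong ⟦_⟧ (does-⇔ x≈y⇔u≈v (x D.≟ y) (u E.≟ v))

  map-enumerates : (f : D.Carrier → E.Carrier) (g : E.Carrier → D.Carrier) →
    Congruent D._≈_ E._≈_ f → Congruent E._≈_ D._≈_ g →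
    (∀ x → g (f x) D.≈ x) → (∀ y → f (g y) E.≈ y) →
    ∀ {xs} → Enumerates D xs → Enumerates E (map f xs)
  map-enumerates f g f-cong g-cong gf≈id fg≈id {xs} enum y =
    trans (sumMap-map f xs (δ E y)) (trans (sumMap-cong xs δ-transport) (enum (g y)))
    where
    δ-transport : ∀ x → δ E y (f x) ≡ δ D (g y) x
    δ-transport x = sym (δ-⇔ (mk⇔ (λ gy≈x → E.trans (E.sym (fg≈id y)) (f-cong gy≈x))
                                   (λ y≈fx → D.trans (g-cong y≈fx) (gf≈id x))))

  cartesianProduct-enumerates : ∀ {xs ys} → Enumerates D xs → Enumerates E ys →
    Enumerates (×.×-decSetoid D E) (cartesianProduct xs ys)
  cartesianProduct-enumerates {xs} {ys} enum-xs enum-ys (x₀ , y₀) = begin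
    sumMap (cartesianProduct xs ys) (δ (×.×-decSetoid D E) (x₀ , y₀))
      ≡⟨ sumMap-cartesianProduct xs ys _ ⟩
    sumMap xs (λ x → sumMap ys (λ y → δ (×.×-decSetoid D E) (x₀ , y₀) (x , y)))
      ≡⟨ sumMap-cong xs (λ x → sumMap-cong ys (λ y → ⟦∧⟧ (does (x₀ D.≟ x)) _)) ⟩
    sumMap xs (λ x → sumMap ys (λ y → δ D x₀ x * δ E y₀ y))
      ≡⟨ sumMap-cong xs (λ x → sumMap-*ˡ ys (δ D x₀ x) (δ E y₀)) ⟩
    sumMap xs (λ x → δ D x₀ x * sumMap ys (δ E y₀))
      ≡⟨ sumMap-cong xs (λ x → trans (cong (δ D x₀ x *_) (enum-ys y₀)) (ℕₚ.*-identityʳ _)) ⟩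
    sumMap xs (δ D x₀)
      ≡⟨ enum-xs x₀ ⟩
    1 ∎
    where open ≡-Reasoning

module _ (D : DecSetoid 0ℓ ℓ₁) where
  open DecSetoid D using (Carrier)

  δ-∷ : ∀ {n} (u : Fin (suc n) → Carrier) x v →
        δ (Pointwise.decSetoid D (suc n)) u (x Vector.∷ v)
        ≡ δ D (u zero) x * δ (Pointwise.decSetoid D n) (Vector.tail u) v
  δ-∷ {n} u x v = trans
    (δ-⇔ (Pointwise.decSetoid D (suc n)) (×.×-decSetoid D (Pointwise.decSetoid D n))
         {u} {x Vector.∷ v} {u zero , Vector.tail u} {x , v}
         (mk⇔ (λ u≈x∷v → u≈x∷v zero , u≈x∷v ∘ suc) (λ { (p , q) zero → p ; (p , q) (suc i) → q i })))
    (⟦∧⟧ (does (DecSetoid._≟_ D (u zero) x)) _)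

  allFuns-enumerates : ∀ {xs} → Enumerates D xs → ∀ n → Enumerates (Pointwise.decSetoid D n) (allFuns xs n)
  allFuns-enumerates enum zero    u = cong (_+ 0) (δ-yes (Pointwise.decSetoid D 0) {u} {λ ()} (λ ()))
  allFuns-enumerates {xs} enum (suc n) u = begin
    sumMap (allFuns xs (suc n)) (δ Dⁿ⁺¹ u)
      ≡⟨ sumMap-allFuns-suc xs n _ ⟩
    sumMap xs (λ x → sumMap (allFuns xs n) (λ v → δ Dⁿ⁺¹ u (x Vector.∷ v)))
      ≡⟨ sumMap-cong xs (λ x → sumMap-cong (allFuns xs n) (δ-∷ u x)) ⟩
    sumMap xs (λ x → sumMap (allFuns xs n) (λ v → δ D (u zero) x * δ Dⁿ (Vector.tail u) v))
      ≡⟨ sumMap-cong xs (λ x → sumMap-*ˡ (allFuns xs n) (δ D (u zero) x) _) ⟩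
    sumMap xs (λ x → δ D (u zero) x * sumMap (allFuns xs n) (δ Dⁿ (Vector.tail u)))
      ≡⟨ sumMap-cong xs (λ x → trans (cong (δ D (u zero) x *_) (allFuns-enumerates enum n _)) (ℕₚ.*-identityʳ _)) ⟩
    sumMap xs (δ D (u zero))
      ≡⟨ enum (u zero) ⟩
    1 ∎
    where
    open ≡-Reasoning
    Dⁿ Dⁿ⁺¹ : DecSetoid 0ℓ ℓ₁
    Dⁿ   = Pointwise.decSetoid D n
    Dⁿ⁺¹ = Pointwise.decSetoid D (suc n)

module _ {A : Set α} (_≟_ : DecidableEquality A) where

  ∉⇒sumMap-δ≡0 : ∀ {x xs} → ¬ x ∈ xs → sumMap xs (δ (≡.decSetoid _≟_) x) ≡ 0
  ∉⇒sumMap-δ≡0 {xs = []}     x∉xs = refl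
  ∉⇒sumMap-δ≡0 {xs = y ∷ xs} x∉xs =
    cong₂ _+_ (δ-no (≡.decSetoid _≟_) (x∉xs ∘ here)) (∉⇒sumMap-δ≡0 (x∉xs ∘ there))

  unique-complete⇒enumerates : ∀ {xs} → Unique xs → (∀ x → x ∈ xs) → Enumerates (≡.decSetoid _≟_) xs
  unique-complete⇒enumerates {xs} unique complete x = once unique (complete x)
    where
    once : ∀ {ys} → Unique ys → x ∈ ys → sumMap ys (δ (≡.decSetoid _≟_) x) ≡ 1
    once (y∉ys ∷ _) (here refl) = cong₂ _+_ (δ-yes (≡.decSetoid _≟_) refl) (∉⇒sumMap-δ≡0 (All¬⇒¬Any y∉ys))
    once (y∉ys ∷ u) (there x∈ys) = trans
      (cong (_+ _) (δ-no (≡.decSetoid _≟_) (λ { refl → All¬⇒¬Any y∉ys x∈ys })))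
      (once u x∈ys)

sumℕ≤ : ℕ → (ℕ → ℕ) → ℕ
sumℕ≤ zero    f = f zero
sumℕ≤ (suc n) f = sumℕ≤ n f + f (suc n)

sumℕ≤-cong : ∀ n {f g : ℕ → ℕ} → f ≗ g → sumℕ≤ n f ≡ sumℕ≤ n g
sumℕ≤-cong zero    f≗g = f≗g zero
sumℕ≤-cong (suc n) f≗g = cong₂ _+_ (sumℕ≤-cong n f≗g) (f≗g (suc n))

sumℕ≤-vanishing : ∀ n f → (∀ r → r ≤ n → f r ≡ 0) → sumℕ≤ n f ≡ 0
sumℕ≤-vanishing zero    f f≡0 = f≡0 zero z≤n
sumℕ≤-vanishing (suc n) f f≡0 =
  cong₂ _+_ (sumℕ≤-vanishing n f (λ r r≤n → f≡0 r (ℕₚ.m≤n⇒m≤1+n r≤n))) (f≡0 (suc n) ℕₚ.≤-refl)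

sumℕ≤-truncate : ∀ n m f → m ≤ n → (∀ r → m < r → f r ≡ 0) → sumℕ≤ n f ≡ sumℕ≤ m f
sumℕ≤-truncate zero    m f m≤n _ rewrite ℕₚ.n≤0⇒n≡0 m≤n = refl
sumℕ≤-truncate (suc n) m f m≤n f≡0 with ℕₚ.m≤n⇒m<n∨m≡n m≤n
... | inj₂ refl = refl
... | inj₁ m<1+n =
  trans (cong₂ _+_ (sumℕ≤-truncate n m f (ℕₚ.≤-pred m<1+n) f≡0) (f≡0 (suc n) m<1+n)) (ℕₚ.+-identityʳ _)

sumMap-sumℕ≤ : ∀ (xs : List A) n (f : A → ℕ → ℕ) →
               sumMap xs (λ x → sumℕ≤ n (f x)) ≡ sumℕ≤ n (λ r → sumMap xs (λ x → f x r))
sumMap-sumℕ≤ xs zero    f = refl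
sumMap-sumℕ≤ xs (suc n) f = trans (sumMap-+ xs _ _) (cong (_+ sumMap xs (λ x → f x (suc n))) (sumMap-sumℕ≤ xs n f))

δℕ : ℕ → ℕ → ℕ
δℕ = δ (≡.decSetoid ℕₚ._≟_)

δℕ-yes : ∀ {x y} → x ≡ y → δℕ x y ≡ 1
δℕ-yes = δ-yes (≡.decSetoid ℕₚ._≟_)

δℕ-no : ∀ {x y} → x ≢ y → δℕ x y ≡ 0
δℕ-no = δ-no (≡.decSetoid ℕₚ._≟_)

δℕ*-subst : ∀ (h : ℕ → ℕ) x y → δℕ x y * h x ≡ δℕ x y * h y
δℕ*-subst h = δ*-subst (≡.decSetoid ℕₚ._≟_) h (cong h)

δℕ²*-subst : ∀ (h : ℕ → ℕ → ℕ) x x′ y y′ →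
             h x y * (δℕ x x′ * δℕ y y′) ≡ h x′ y′ * (δℕ x x′ * δℕ y y′)
δℕ²*-subst h x x′ y y′ = begin
  h x y * (δℕ x x′ * δℕ y y′)    ≡⟨ rearrange (h x y) (δℕ x x′) (δℕ y y′) ⟩
  δℕ y y′ * (δℕ x x′ * h x y)    ≡⟨ cong (δℕ y y′ *_) (δℕ*-subst (λ z → h z y) x x′) ⟩
  δℕ y y′ * (δℕ x x′ * h x′ y)   ≡⟨ ℕ*.x∙yz≈y∙xz (δℕ y y′) (δℕ x x′) (h x′ y) ⟩
  δℕ x x′ * (δℕ y y′ * h x′ y)   ≡⟨ cong (δℕ x x′ *_) (δℕ*-subst (h x′) y y′) ⟩
  δℕ x x′ * (δℕ y y′ * h x′ y′)  ≡⟨ rearrange′ (h x′ y′) (δℕ x x′) (δℕ y y′) ⟨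
  h x′ y′ * (δℕ x x′ * δℕ y y′)  ∎
  where
  open ≡-Reasoning
  rearrange : ∀ z u v → z * (u * v) ≡ v * (u * z)
  rearrange = solve-∀
  rearrange′ : ∀ z u v → z * (u * v) ≡ u * (v * z)
  rearrange′ = solve-∀

sumℕ≤-δℕ : ∀ n ρ (h : ℕ → ℕ) → ρ ≤ n → sumℕ≤ n (λ r → δℕ ρ r * h r) ≡ h ρ
sumℕ≤-δℕ zero ρ h ρ≤0 rewrite ℕₚ.n≤0⇒n≡0 ρ≤0 = ℕₚ.+-identityʳ (h 0)
sumℕ≤-δℕ (suc n) ρ h ρ≤1+n with ℕₚ.m≤n⇒m<n∨m≡n ρ≤1+n
... | inj₁ ρ<1+n = trans (cong (sumℕ≤ n (λ r → δℕ ρ r * h r) +_) (cong (_* h (suc n)) (δℕ-no (ℕₚ.<⇒≢ ρ<1+n))))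
                        (trans (ℕₚ.+-identityʳ _) (sumℕ≤-δℕ n ρ h (ℕₚ.≤-pred ρ<1+n)))
... | inj₂ refl  = trans (cong₂ _+_ (sumℕ≤-vanishing n _ (λ r r≤n → cong (_* h r) (δℕ-no (ℕₚ.>⇒≢ (s≤s r≤n)))))
                                   (cong (_* h (suc n)) (δℕ-yes {suc n} refl)))
                         (ℕₚ.+-identityʳ _)

-- ℚᵘ.mkℚᵘ a d stands for a / (d + 1); equations between fracs are checked on these representatives.
frac-toℚᵘ : ∀ a d → ℚ.toℚᵘ (frac a (suc d)) ℚᵘ.≃ ℚᵘ.mkℚᵘ a d
frac-toℚᵘ a d = ℚₚ.toℚᵘ-fromℚᵘ (ℚᵘ.mkℚᵘ a d)

frac-cross : ∀ a c d e → a ℤ.* ℤ.+ suc e ≡ c ℤ.* ℤ.+ suc d → frac a (suc d) ≡ frac c (suc e)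
frac-cross a c d e eq = ℚₚ.toℚᵘ-injective
  (ℚᵘₚ.≃-trans (frac-toℚᵘ a d) (ℚᵘₚ.≃-trans (ℚᵘ.*≡* eq) (ℚᵘₚ.≃-sym (frac-toℚᵘ c e))))

frac-* : ∀ a c d e → frac a (suc d) ℚ.* frac c (suc e) ≡ frac (a ℤ.* c) (suc d * suc e)
frac-* a c d e = ℚₚ.toℚᵘ-injective (ℚᵘₚ.≃-trans (ℚₚ.toℚᵘ-homo-* (frac a (suc d)) (frac c (suc e)))
  (ℚᵘₚ.≃-trans (ℚᵘₚ.*-cong (frac-toℚᵘ a d) (frac-toℚᵘ c e))
               (ℚᵘₚ.≃-sym (frac-toℚᵘ (a ℤ.* c) (e + d * suc e)))))

frac-+ : ∀ a c d → frac a (suc d) ℚ.+ frac c (suc d) ≡ frac (a ℤ.+ c) (suc d)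
frac-+ a c d = ℚₚ.toℚᵘ-injective (ℚᵘₚ.≃-trans (ℚₚ.toℚᵘ-homo-+ (frac a (suc d)) (frac c (suc d)))
  (ℚᵘₚ.≃-trans (ℚᵘₚ.+-cong (frac-toℚᵘ a d) (frac-toℚᵘ c d))
               (ℚᵘₚ.≃-trans (ℚᵘ.*≡* (cross a c (ℤ.+ suc d))) (ℚᵘₚ.≃-sym (frac-toℚᵘ (a ℤ.+ c) d)))))
  where
  cross : ∀ a c d → (a ℤ.* d ℤ.+ c ℤ.* d) ℤ.* d ≡ (a ℤ.+ c) ℤ.* (d ℤ.* d)
  cross = ℤ-solve-∀

frac-*ℕ : ∀ x x′ y y′ → 0 < y → 0 < y′ →
          frac (ℤ.+ x) y ℚ.* frac (ℤ.+ x′) y′ ≡ frac (ℤ.+ (x * x′)) (y * y′)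
frac-*ℕ x x′ (suc y) (suc y′) _ _ =
  trans (frac-* (ℤ.+ x) (ℤ.+ x′) y y′) (cong (λ n → frac n (suc y * suc y′)) (sym (ℤₚ.pos-* x x′)))

frac-cancelʳ : ∀ x y c → 0 < y → 0 < c → frac (ℤ.+ (x * c)) (y * c) ≡ frac (ℤ.+ x) y
frac-cancelʳ x (suc y) (suc c) _ _ = frac-cross (ℤ.+ (x * suc c)) (ℤ.+ x) (c + y * suc c) y (begin
  ℤ.+ (x * suc c) ℤ.* ℤ.+ suc y       ≡⟨ ℤₚ.pos-* (x * suc c) (suc y) ⟨
  ℤ.+ (x * suc c * suc y)           ≡⟨ cong ℤ.+_ (rearrange x (suc c) (suc y)) ⟩
  ℤ.+ (x * (suc y * suc c))         ≡⟨ ℤₚ.pos-* x (suc y * suc c) ⟩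
  ℤ.+ x ℤ.* ℤ.+ (suc y * suc c)       ∎)
  where
  open ≡-Reasoning
  rearrange : ∀ x c y → x * c * y ≡ x * (y * c)
  rearrange = solve-∀

sumQ≤-frac : ∀ n f d → 0 < d → sumQ≤ n (λ r → frac (ℤ.+ f r) d) ≡ frac (ℤ.+ sumℕ≤ n f) d
sumQ≤-frac zero    f d       _   = refl
sumQ≤-frac (suc n) f (suc d) 0<d = begin
  sumQ≤ n (λ r → frac (ℤ.+ f r) (suc d)) ℚ.+ frac (ℤ.+ f (suc n)) (suc d)
    ≡⟨ cong (ℚ._+ frac (ℤ.+ f (suc n)) (suc d)) (sumQ≤-frac n f (suc d) 0<d) ⟩
  frac (ℤ.+ sumℕ≤ n f) (suc d) ℚ.+ frac (ℤ.+ f (suc n)) (suc d)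
    ≡⟨ frac-+ (ℤ.+ sumℕ≤ n f) (ℤ.+ f (suc n)) d ⟩
  frac (ℤ.+ sumℕ≤ n f ℤ.+ ℤ.+ f (suc n)) (suc d)
    ≡⟨ cong (λ a → frac a (suc d)) (ℤₚ.pos-+ (sumℕ≤ n f) (f (suc n))) ⟨
  frac (ℤ.+ sumℕ≤ (suc n) f) (suc d) ∎
  where open ≡-Reasoning

sumQ≤-cong : ∀ n {f g : ℕ → ℚ.ℚ} → f ≗ g → sumQ≤ n f ≡ sumQ≤ n g
sumQ≤-cong zero    f≗g = f≗g zero
sumQ≤-cong (suc n) f≗g = cong₂ ℚ._+_ (sumQ≤-cong n f≗g) (f≗g (suc n))

prob-cartesianProduct : ∀ (xs : List A) (ys : List B) p p′ E →
  prob (cartesianProduct (filterᵇ p xs) (filterᵇ p′ ys)) E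
  ≡ frac (ℤ.+ sumMap xs (λ x → ⟦ p x ⟧ * sumMap ys (λ y → ⟦ p′ y ⟧ * ⟦ E (x , y) ⟧))) (count xs p * count ys p′)
prob-cartesianProduct xs ys p p′ E = cong₂ (λ k l → frac (ℤ.+ k) l) events outcomes
  where
  open ≡-Reasoning
  events : count (cartesianProduct (filterᵇ p xs) (filterᵇ p′ ys)) E
           ≡ sumMap xs (λ x → ⟦ p x ⟧ * sumMap ys (λ y → ⟦ p′ y ⟧ * ⟦ E (x , y) ⟧))
  events = begin
    count (cartesianProduct (filterᵇ p xs) (filterᵇ p′ ys)) E
      ≡⟨ count≡sumMap (cartesianProduct (filterᵇ p xs) (filterᵇ p′ ys)) E ⟩
    sumMap (cartesianProduct (filterᵇ p xs) (filterᵇ p′ ys)) (λ z → ⟦ E z ⟧)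
      ≡⟨ sumMap-cartesianProduct (filterᵇ p xs) (filterᵇ p′ ys) _ ⟩
    sumMap (filterᵇ p xs) (λ x → sumMap (filterᵇ p′ ys) (λ y → ⟦ E (x , y) ⟧))
      ≡⟨ sumMap-filterᵇ p xs _ ⟩
    sumMap xs (λ x → ⟦ p x ⟧ * sumMap (filterᵇ p′ ys) (λ y → ⟦ E (x , y) ⟧))
      ≡⟨ sumMap-cong xs (λ x → cong (⟦ p x ⟧ *_) (sumMap-filterᵇ p′ ys _)) ⟩
    sumMap xs (λ x → ⟦ p x ⟧ * sumMap ys (λ y → ⟦ p′ y ⟧ * ⟦ E (x , y) ⟧)) ∎
  outcomes : length (cartesianProduct (filterᵇ p xs) (filterᵇ p′ ys)) ≡ count xs p * count ys p′
  outcomes = begin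
    length (cartesianProduct (filterᵇ p xs) (filterᵇ p′ ys))
      ≡⟨ length≡sumMap (cartesianProduct (filterᵇ p xs) (filterᵇ p′ ys)) ⟩
    sumMap (cartesianProduct (filterᵇ p xs) (filterᵇ p′ ys)) (λ _ → 1)
      ≡⟨ sumMap-cartesianProduct (filterᵇ p xs) (filterᵇ p′ ys) _ ⟩
    sumMap (filterᵇ p xs) (λ _ → sumMap (filterᵇ p′ ys) (λ _ → 1))
      ≡⟨ sumMap-const (filterᵇ p xs) _ ⟩
    sumMap (filterᵇ p′ ys) (λ _ → 1) * count xs p
      ≡⟨ cong (_* count xs p) (length≡sumMap (filterᵇ p′ ys)) ⟨
    count ys p′ * count xs p
      ≡⟨ ℕₚ.*-comm (count ys p′) (count xs p) ⟩
    count xs p * count ys p′ ∎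

-- Linear algebra over a finite field

module LinearAlgebra (K : FiniteField) where
  open FiniteField K public using (F; 0#; 1#; _≟_; elems; inverse)
  open FiniteField K public using (isCommutativeRing) renaming (_+_ to infixl 6 _+ᶠ_; _*_ to infixl 7 _*ᶠ_; -_ to infix 8 -ᶠ_)
  open FF K public using (Mat; ∑; _⊗_)
  open IsCommutativeRing isCommutativeRing public
    using (+-assoc; +-comm; +-identityˡ; +-identityʳ; -‿inverseˡ; -‿inverseʳ;
           *-assoc; *-comm; *-identityˡ; *-identityʳ; distribˡ; distribʳ; zeroˡ; zeroʳ)

  ring : CommutativeRing 0ℓ 0ℓ
  ring = record { isCommutativeRing = isCommutativeRing }

  open import Algebra.Properties.Ring (CommutativeRing.ring ring) public
    using (-0#≈0#; -‿involutive; -‿distribˡ-*; +-inverseʳ-unique; +-identityʳ-unique)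
  open import Algebra.Properties.CommutativeSemigroup (CommutativeRing.+-commutativeSemigroup ring)
    using () renaming (interchange to +-interchange)
  open import Algebra.Properties.CommutativeSemigroup (CommutativeRing.*-commutativeSemigroup ring)
    using (x∙yz≈y∙xz)

  infixl 7 _*ₛ_ _·_
  infixl 6 _+ᵛ_
  infix 4 _≋_
  infix 30 _ᵀ

  ∑-cong : ∀ k {f g : Fin k → F} → f ≗ g → ∑ k f ≡ ∑ k g
  ∑-cong zero    f≗g = refl
  ∑-cong (suc k) f≗g = cong₂ _+ᶠ_ (f≗g zero) (∑-cong k (f≗g ∘ suc))

  ∑-zero : ∀ k → ∑ k (λ _ → 0#) ≡ 0#
  ∑-zero zero    = refl
  ∑-zero (suc k) = trans (cong (0# +ᶠ_) (∑-zero k)) (+-identityˡ 0#)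

  ∑-+ : ∀ k (f g : Fin k → F) → ∑ k (λ i → f i +ᶠ g i) ≡ ∑ k f +ᶠ ∑ k g
  ∑-+ zero    f g = sym (+-identityˡ 0#)
  ∑-+ (suc k) f g = trans (cong (f zero +ᶠ g zero +ᶠ_) (∑-+ k (f ∘ suc) (g ∘ suc))) (+-interchange _ _ _ _)

  ∑-*ˡ : ∀ k c (f : Fin k → F) → ∑ k (λ i → c *ᶠ f i) ≡ c *ᶠ ∑ k f
  ∑-*ˡ zero    c f = sym (zeroʳ c)
  ∑-*ˡ (suc k) c f = trans (cong (c *ᶠ f zero +ᶠ_) (∑-*ˡ k c (f ∘ suc))) (sym (distribˡ c _ _))

  ∑-*ʳ : ∀ k c (f : Fin k → F) → ∑ k (λ i → f i *ᶠ c) ≡ ∑ k f *ᶠ c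
  ∑-*ʳ k c f = trans (∑-cong k (λ i → *-comm (f i) c)) (trans (∑-*ˡ k c f) (*-comm c _))

  ∑-swap : ∀ a b (f : Fin a → Fin b → F) → ∑ a (λ i → ∑ b (f i)) ≡ ∑ b (λ j → ∑ a (λ i → f i j))
  ∑-swap zero    b f = sym (∑-zero b)
  ∑-swap (suc a) b f = trans (cong (∑ b (f zero) +ᶠ_) (∑-swap a b (f ∘ suc))) (sym (∑-+ b (f zero) _))

  ∑-single : ∀ k (j : Fin k) (f : Fin k → F) → (∀ i → i ≢ j → f i ≡ 0#) → ∑ k f ≡ f j
  ∑-single (suc k) zero    f f≡0 =
    trans (cong (f zero +ᶠ_) (trans (∑-cong k (λ i → f≡0 (suc i) (λ ()))) (∑-zero k))) (+-identityʳ _)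
  ∑-single (suc k) (suc j) f f≡0 =
    trans (cong (_+ᶠ ∑ k (f ∘ suc)) (f≡0 zero (λ ())))
          (trans (+-identityˡ _) (∑-single k j (f ∘ suc) (λ i i≢j → f≡0 (suc i) (i≢j ∘ Finₚ.suc-injective))))

  0ᵛ : ∀ {n} → Vector F n
  0ᵛ _ = 0#

  _+ᵛ_ : ∀ {n} → Vector F n → Vector F n → Vector F n
  (x +ᵛ y) i = x i +ᶠ y i

  -ᵛ_ : ∀ {n} → Vector F n → Vector F n
  (-ᵛ x) i = -ᶠ x i

  _*ₛ_ : ∀ {n} → F → Vector F n → Vector F n
  (c *ₛ x) i = c *ᶠ x i

  x+t-t≗x : ∀ {n} (x t : Vector F n) → x +ᵛ t +ᵛ -ᵛ t ≗ x
  x+t-t≗x x t i = trans (+-assoc (x i) (t i) _) (trans (cong (x i +ᶠ_) (-‿inverseʳ (t i))) (+-identityʳ (x i)))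

  x-t+t≗x : ∀ {n} (x t : Vector F n) → x +ᵛ -ᵛ t +ᵛ t ≗ x
  x-t+t≗x x t i = trans (+-assoc (x i) _ (t i)) (trans (cong (x i +ᶠ_) (-‿inverseˡ (t i))) (+-identityʳ (x i)))

  basis : ∀ {n} → Fin n → Vector F n
  basis j i = if does (j Finₚ.≟ i) then 1# else 0#

  _·_ : ∀ {a b} → Mat a b → Vector F b → Vector F a
  (Y · x) i = ∑ _ (λ j → Y i j *ᶠ x j)

  _ᵀ : ∀ {a b} → Mat a b → Mat b a
  (X ᵀ) i j = X j i

  _∙_ : ∀ {n} → Vector F n → Vector F n → F
  u ∙ v = ∑ _ (λ i → u i *ᶠ v i)

  Row : ∀ {n} → Vector F n → Mat 1 n
  Row w _ = w

  _∷ᶜ_ : ∀ {a k} → Vector F a → Mat a k → Mat a (suc k)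
  (w ∷ᶜ D) i = w i Vector.∷ D i

  _≋_ : ∀ {a b} → Mat a b → Mat a b → Set
  X ≋ Y = ∀ i j → X i j ≡ Y i j

  ·-congʳ : ∀ {a b} (Y : Mat a b) {x y} → x ≗ y → Y · x ≗ Y · y
  ·-congʳ Y x≗y i = ∑-cong _ (λ j → cong (Y i j *ᶠ_) (x≗y j))

  ·-congˡ : ∀ {a b} {X Y : Mat a b} → X ≋ Y → ∀ x → X · x ≗ Y · x
  ·-congˡ X≋Y x i = ∑-cong _ (λ j → cong (_*ᶠ x j) (X≋Y i j))

  ·-zero : ∀ {a b} (Y : Mat a b) → Y · 0ᵛ ≗ 0ᵛ
  ·-zero {b = b} Y i = trans (∑-cong b (λ j → zeroʳ (Y i j))) (∑-zero b)

  ·-+ᵛ : ∀ {a b} (Y : Mat a b) x y → Y · (x +ᵛ y) ≗ Y · x +ᵛ Y · y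
  ·-+ᵛ {b = b} Y x y i = trans (∑-cong b (λ j → distribˡ (Y i j) (x j) (y j))) (∑-+ b _ _)

  ·-*ₛ : ∀ {a b} (Y : Mat a b) c x → Y · (c *ₛ x) ≗ c *ₛ (Y · x)
  ·-*ₛ {b = b} Y c x i = trans (∑-cong b (λ j → x∙yz≈y∙xz (Y i j) c (x j))) (∑-*ˡ b c _)

  ·-basis : ∀ {a b} (Y : Mat a b) j → Y · basis j ≗ λ i → Y i j
  ·-basis Y j i = trans (∑-single _ j _ off-j) (trans (cong (Y i j *ᶠ_) basis-j-j) (*-identityʳ _))
    where
    off-j : ∀ t → t ≢ j → Y i t *ᶠ basis j t ≡ 0#
    off-j t t≢j with j Finₚ.≟ t
    ... | yes j≡t = ⊥-elim (t≢j (sym j≡t))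
    ... | no _    = zeroʳ (Y i t)
    basis-j-j : basis j j ≡ 1#
    basis-j-j with j Finₚ.≟ j
    ... | yes _   = refl
    ... | no j≢j = ⊥-elim (j≢j refl)

  ⊗-· : ∀ {a k b} (A : Mat a k) (B : Mat k b) x → (A ⊗ B) · x ≗ A · (B · x)
  ⊗-· {k = k} {b} A B x i = begin
    ∑ b (λ j → ∑ k (λ t → A i t *ᶠ B t j) *ᶠ x j)
      ≡⟨ ∑-cong b (λ j → sym (∑-*ʳ k (x j) _)) ⟩
    ∑ b (λ j → ∑ k (λ t → A i t *ᶠ B t j *ᶠ x j))
      ≡⟨ ∑-swap b k _ ⟩
    ∑ k (λ t → ∑ b (λ j → A i t *ᶠ B t j *ᶠ x j))
      ≡⟨ ∑-cong k (λ t → ∑-cong b (λ j → *-assoc (A i t) (B t j) (x j))) ⟩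
    ∑ k (λ t → ∑ b (λ j → A i t *ᶠ (B t j *ᶠ x j)))
      ≡⟨ ∑-cong k (λ t → ∑-*ˡ b (A i t) _) ⟩
    ∑ k (λ t → A i t *ᶠ ∑ b (λ j → B t j *ᶠ x j)) ∎
    where open ≡-Reasoning

  ⊗-cong : ∀ {a k b} {A A′ : Mat a k} {B B′ : Mat k b} → A ≋ A′ → B ≋ B′ → A ⊗ B ≋ A′ ⊗ B′
  ⊗-cong A≋A′ B≋B′ i j = ∑-cong _ (λ t → cong₂ _*ᶠ_ (A≋A′ i t) (B≋B′ t j))

  ᵀ-⊗ : ∀ {a k b} (A : Mat a k) (B : Mat k b) → (A ⊗ B) ᵀ ≋ B ᵀ ⊗ A ᵀ
  ᵀ-⊗ A B i j = ∑-cong _ (λ t → *-comm (A j t) (B t i))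

  ⊗-∷ᶜ : ∀ {a b k} (Y : Mat a b) v (C : Mat b k) → Y ⊗ (v ∷ᶜ C) ≋ (Y · v) ∷ᶜ (Y ⊗ C)
  ⊗-∷ᶜ Y v C i zero    = refl
  ⊗-∷ᶜ Y v C i (suc j) = refl

  ∙-comm : ∀ {n} (u v : Vector F n) → u ∙ v ≡ v ∙ u
  ∙-comm u v = ∑-cong _ (λ i → *-comm (u i) (v i))

  ∙-· : ∀ {a b} (X : Mat a b) y x → y ∙ (X · x) ≡ (X ᵀ · y) ∙ x
  ∙-· {a} {b} X y x = begin
    ∑ a (λ i → y i *ᶠ ∑ b (λ j → X i j *ᶠ x j))
      ≡⟨ ∑-cong a (λ i → sym (∑-*ˡ b (y i) _)) ⟩
    ∑ a (λ i → ∑ b (λ j → y i *ᶠ (X i j *ᶠ x j)))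
      ≡⟨ ∑-swap a b _ ⟩
    ∑ b (λ j → ∑ a (λ i → y i *ᶠ (X i j *ᶠ x j)))
      ≡⟨ ∑-cong b (λ j → ∑-cong a (λ i → sym (*-assoc (y i) (X i j) (x j)))) ⟩
    ∑ b (λ j → ∑ a (λ i → y i *ᶠ X i j *ᶠ x j))
      ≡⟨ ∑-cong b (λ j → trans (∑-cong a (λ i → cong (_*ᶠ x j) (*-comm (y i) (X i j)))) (∑-*ʳ a (x j) _)) ⟩
    ∑ b (λ j → ∑ a (λ i → X i j *ᶠ y i) *ᶠ x j) ∎
    where open ≡-Reasoning

-- Sizes of kernels and images

module KernelsAndImages (K : FiniteField) where
  open LinearAlgebra K public
  open FF K public using (q; allMats)
  open FiniteField K using (complete; unique; 0≢1)

  𝔽-decSetoid : DecSetoid 0ℓ 0ℓ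
  𝔽-decSetoid = ≡.decSetoid _≟_

  Vector-decSetoid : ℕ → DecSetoid 0ℓ 0ℓ
  Vector-decSetoid = Pointwise.decSetoid 𝔽-decSetoid

  Mat-decSetoid : ℕ → ℕ → DecSetoid 0ℓ 0ℓ
  Mat-decSetoid a b = Pointwise.decSetoid (Vector-decSetoid b) a

  δᵛ : ∀ {n} → Vector F n → Vector F n → ℕ
  δᵛ = δ (Vector-decSetoid _)

  allVecs : ∀ n → List (Vector F n)
  allVecs = allFuns elems

  elems-enumerates : Enumerates 𝔽-decSetoid elems
  elems-enumerates = unique-complete⇒enumerates _≟_ unique complete

  allVecs-enumerates : ∀ n → Enumerates (Vector-decSetoid n) (allVecs n)
  allVecs-enumerates = allFuns-enumerates 𝔽-decSetoid elems-enumerates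

  allMats-enumerates : ∀ a b → Enumerates (Mat-decSetoid a b) (allMats a b)
  allMats-enumerates a b = allFuns-enumerates (Vector-decSetoid b) (allVecs-enumerates b) a

  length-allVecs : ∀ n → length (allVecs n) ≡ q ^ n
  length-allVecs = length-allFuns elems

  2≤q : 2 ≤ q
  2≤q = distinct-∈⇒2≤length unique (complete 0#) (complete 1#) 0≢1

  instance
    q-nonZero : ℕ.NonZero q
    q-nonZero = ℕ.>-nonZero (ℕₚ.≤-trans (s≤s z≤n) 2≤q)

  sumMap-translate : ∀ n (t : Vector F n) f → Congruent _≗_ _≡_ f →
                     sumMap (allVecs n) f ≡ sumMap (allVecs n) (λ x → f (x +ᵛ t))
  sumMap-translate n t f f-cong = trans
    (sumMap-enumeration-invariant (Vector-decSetoid n) {allVecs n} {map (_+ᵛ t) (allVecs n)} (allVecs-enumerates n) translates f f-cong)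
    (sumMap-map (_+ᵛ t) (allVecs n) f)
    where
    translates : Enumerates (Vector-decSetoid n) (map (_+ᵛ t) (allVecs n))
    translates = map-enumerates (Vector-decSetoid n) (Vector-decSetoid n) (_+ᵛ t) (_+ᵛ -ᵛ t)
      (λ x≗y i → cong (_+ᶠ t i) (x≗y i)) (λ x≗y i → cong (_+ᶠ -ᶠ t i) (x≗y i))
      (λ x → x+t-t≗x x t) (λ x → x-t+t≗x x t) {allVecs n} (allVecs-enumerates n)

  Injective : ∀ {a b} → Mat a b → Set
  Injective Y = ∀ x → Y · x ≗ 0ᵛ → x ≗ 0ᵛ

  module _ {a b} (Y : Mat a b) where

    InImage : Vector F a → Set
    InImage y = ∃[ x ] Y · x ≗ y

    inImage? : ∀ y → Dec (InImage y)
    inImage? y = map′ Any.satisfied listed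
                      (any? (λ x → DecSetoid._≟_ (Vector-decSetoid a) (Y · x) y) (allVecs b))
      where
      listed : InImage y → Any (λ x → Y · x ≗ y) (allVecs b)
      listed (x , Yx≗y) = Any.map (λ x≗x′ i → trans (sym (·-congʳ Y x≗x′ i)) (Yx≗y i))
                                  (enumerates⇒any (Vector-decSetoid b) (allVecs b) (allVecs-enumerates b) x)

    χim : Vector F a → ℕ
    χim y = ⟦ does (inImage? y) ⟧

    #ker : ℕ
    #ker = sumMap (allVecs b) (λ x → δᵛ 0ᵛ (Y · x))

    #im : ℕ
    #im = sumMap (allVecs a) χim

    χim-yes : ∀ {y} → InImage y → χim y ≡ 1
    χim-yes {y} y∈ = cong ⟦_⟧ (dec-true (inImage? y) y∈)

    χim-no : ∀ {y} → ¬ InImage y → χim y ≡ 0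
    χim-no {y} y∉ = cong ⟦_⟧ (dec-false (inImage? y) y∉)

    χim≤1 : ∀ y → χim y ≤ 1
    χim≤1 y = ⟦⟧≤1 (does (inImage? y))

    χim-cong : Congruent _≗_ _≡_ χim
    χim-cong {y} {y′} y≗y′ = cong ⟦_⟧ (does-⇔ (mk⇔ (λ (x , e) → x , λ i → trans (e i) (y≗y′ i))
                                                   (λ (x , e) → x , λ i → trans (e i) (sym (y≗y′ i))))
                                              (inImage? y) (inImage? y′))

    fibre-size : ∀ y → sumMap (allVecs b) (λ x → δᵛ y (Y · x)) ≡ χim y * #ker
    fibre-size y with inImage? y
    ... | no y∉ = begin
      sumMap (allVecs b) (λ x → δᵛ y (Y · x))
        ≡⟨ sumMap-cong (allVecs b) (λ x → δ-no (Vector-decSetoid a) (λ y≗Yx → y∉ (x , λ i → sym (y≗Yx i)))) ⟩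
      sumMap (allVecs b) (λ _ → 0)
        ≡⟨ sumMap-zero (allVecs b) ⟩
      0 * #ker
        ≡⟨ cong (_* #ker) (χim-no y∉) ⟨
      χim y * #ker ∎
      where open ≡-Reasoning
    ... | yes (x₀ , Yx₀≗y) = begin
      sumMap (allVecs b) (λ x → δᵛ y (Y · x))
        ≡⟨ sumMap-translate b x₀ _ (δ-congʳ (Vector-decSetoid a) y ∘ ·-congʳ Y) ⟩
      sumMap (allVecs b) (λ x → δᵛ y (Y · (x +ᵛ x₀)))
        ≡⟨ sumMap-cong (allVecs b) (λ x → δ-⇔ (Vector-decSetoid a) (Vector-decSetoid a) (coset x)) ⟩
      #ker
        ≡⟨ ℕₚ.+-identityʳ #ker ⟨
      1 * #ker
        ≡⟨ cong (_* #ker) (χim-yes (x₀ , Yx₀≗y)) ⟨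
      χim y * #ker ∎
      where
      open ≡-Reasoning
      Y[x+x₀]≡y+Yx : ∀ x i → (Y · (x +ᵛ x₀)) i ≡ y i +ᶠ (Y · x) i
      Y[x+x₀]≡y+Yx x i = trans (·-+ᵛ Y x x₀ i) (trans (cong ((Y · x) i +ᶠ_) (Yx₀≗y i)) (+-comm _ _))
      coset : ∀ x → (y ≗ Y · (x +ᵛ x₀)) ⇔ (0ᵛ ≗ Y · x)
      coset x = mk⇔ (λ e i → sym (+-identityʳ-unique (y i) _ (sym (trans (e i) (Y[x+x₀]≡y+Yx x i)))))
                    (λ e i → sym (trans (Y[x+x₀]≡y+Yx x i) (trans (cong (y i +ᶠ_) (sym (e i))) (+-identityʳ (y i)))))

    #im*#ker≡q^b : #im * #ker ≡ q ^ b
    #im*#ker≡q^b = begin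
      #im * #ker
        ≡⟨ sumMap-*ʳ (allVecs a) #ker χim ⟨
      sumMap (allVecs a) (λ y → χim y * #ker)
        ≡⟨ sumMap-cong (allVecs a) fibre-size ⟨
      sumMap (allVecs a) (λ y → sumMap (allVecs b) (λ x → δᵛ y (Y · x)))
        ≡⟨ sumMap-swap (allVecs a) (allVecs b) _ ⟩
      sumMap (allVecs b) (λ x → sumMap (allVecs a) (λ y → δᵛ y (Y · x)))
        ≡⟨ sumMap-cong (allVecs b) each-once ⟩
      sumMap (allVecs b) (λ _ → 1)
        ≡⟨ length≡sumMap (allVecs b) ⟨
      length (allVecs b)
        ≡⟨ length-allVecs b ⟩
      q ^ b ∎
      where
      open ≡-Reasoning
      each-once : ∀ x → sumMap (allVecs a) (λ y → δᵛ y (Y · x)) ≡ 1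
      each-once x = trans (sumMap-cong (allVecs a) (λ y → δ-sym (Vector-decSetoid a) y (Y · x)))
                          (allVecs-enumerates a (Y · x))

    ker-indicator-cong : Congruent _≗_ _≡_ (λ x → δᵛ 0ᵛ (Y · x))
    ker-indicator-cong = δ-congʳ (Vector-decSetoid a) 0ᵛ ∘ ·-congʳ Y

    1≤#ker : 1 ≤ #ker
    1≤#ker = ℕₚ.≤-trans (ℕₚ.≤-reflexive (sym (δ-yes (Vector-decSetoid a) (λ i → sym (·-zero Y i)))))
                        (≤-sumMap (Vector-decSetoid b) (allVecs b) (allVecs-enumerates b) _ ker-indicator-cong 0ᵛ)

    #im≤q^a : #im ≤ q ^ a
    #im≤q^a = begin
      #im                           ≤⟨ sumMap-mono-≤ (allVecs a) χim≤1 ⟩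
      sumMap (allVecs a) (λ _ → 1)  ≡⟨ length≡sumMap (allVecs a) ⟨
      length (allVecs a)            ≡⟨ length-allVecs a ⟩
      q ^ a                         ∎
      where open ℕₚ.≤-Reasoning

    #im≤q^b : #im ≤ q ^ b
    #im≤q^b = ℕₚ.≤-trans (ℕₚ.m≤m*n #im #ker {{ℕ.>-nonZero 1≤#ker}}) (ℕₚ.≤-reflexive #im*#ker≡q^b)

    injective⇒#ker≡1 : Injective Y → #ker ≡ 1
    injective⇒#ker≡1 inj =
      trans (sumMap-cong (allVecs b) (λ x → δ-⇔ (Vector-decSetoid a) (Vector-decSetoid b) (kernel-trivial x)))
            (allVecs-enumerates b 0ᵛ)
      where
      kernel-trivial : ∀ x → (0ᵛ ≗ Y · x) ⇔ (0ᵛ ≗ x)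
      kernel-trivial x = mk⇔ (λ e i → sym (inj x (λ j → sym (e j)) i))
                             (λ e i → sym (trans (·-congʳ Y (λ j → sym (e j)) i) (·-zero Y i)))

    #ker≡1⇒injective : #ker ≡ 1 → Injective Y
    #ker≡1⇒injective #ker≡1 x Yx≗0 with DecSetoid._≟_ (Vector-decSetoid b) x 0ᵛ
    ... | yes x≗0 = x≗0
    ... | no x≉0  = ⊥-elim (ℕₚ.<-irrefl (sym #ker≡1)
      (2≤sumMap (Vector-decSetoid b) (allVecs b) (allVecs-enumerates b) _ ker-indicator-cong
                x≉0 (in-kernel x (λ i → sym (Yx≗0 i))) (in-kernel 0ᵛ (λ i → sym (·-zero Y i)))))
      where
      in-kernel : ∀ z → 0ᵛ ≗ Y · z → 1 ≤ δᵛ 0ᵛ (Y · z)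
      in-kernel z e = ℕₚ.≤-reflexive (sym (δ-yes (Vector-decSetoid a) e))

  injective⇒#im≡q^b : ∀ {a b} (Y : Mat a b) → Injective Y → #im Y ≡ q ^ b
  injective⇒#im≡q^b Y inj =
    trans (sym (ℕₚ.*-identityʳ (#im Y))) (trans (cong (#im Y *_) (sym (injective⇒#ker≡1 Y inj))) (#im*#ker≡q^b Y))

  χim-mono : ∀ {a b c} (X : Mat a b) (Y : Mat a c) {y} → (InImage X y → InImage Y y) → χim X y ≤ χim Y y
  χim-mono X Y {y} = ⟦does⟧-mono (inImage? X y) (inImage? Y y)

  #im-mono : ∀ {a b c} (X : Mat a b) (Y : Mat a c) → (∀ x → InImage Y (X · x)) → #im X ≤ #im Y
  #im-mono {a} X Y im⊆ = sumMap-mono-≤ (allVecs a) (λ y → χim-mono X Y (λ (x , Xx≗y) →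
    let (x′ , Yx′≗Xx) = im⊆ x in x′ , λ i → trans (Yx′≗Xx i) (Xx≗y i)))

  #im-cong : ∀ {a b} {X Y : Mat a b} → X ≋ Y → #im X ≡ #im Y
  #im-cong {a} {X = X} {Y} X≋Y = ℕₚ.≤-antisym
    (#im-mono X Y (λ x → x , λ i → sym (·-congˡ X≋Y x i)))
    (#im-mono Y X (λ x → x , ·-congˡ X≋Y x))

  χim-cases : ∀ {a b} (D : Mat a b) v (P : ℕ → Set) → (InImage D v → P 1) → (¬ InImage D v → P 0) → P (χim D v)
  χim-cases D v P in-case out-case with inImage? D v
  ... | yes v∈ = subst P (sym (χim-yes D v∈)) (in-case v∈)
  ... | no v∉  = subst P (sym (χim-no D v∉)) (out-case v∉)

  sumMap-χim-· : ∀ {a b c} (Y : Mat a b) (Z : Mat a c) → (∀ {y} → InImage Z y → InImage Y y) →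
    sumMap (allVecs b) (λ v → χim Z (Y · v)) ≡ #im Z * #ker Y
  sumMap-χim-· {a} {b} Y Z im⊆ = begin
    sumMap (allVecs b) (λ v → χim Z (Y · v))
      ≡⟨ sumMap-cong (allVecs b) (λ v →
           sumMap-δ (Vector-decSetoid a) (allVecs a) (allVecs-enumerates a) (χim Z) (χim-cong Z) (Y · v)) ⟨
    sumMap (allVecs b) (λ v → sumMap (allVecs a) (λ y → δᵛ (Y · v) y * χim Z y))
      ≡⟨ sumMap-swap (allVecs b) (allVecs a) _ ⟩
    sumMap (allVecs a) (λ y → sumMap (allVecs b) (λ v → δᵛ (Y · v) y * χim Z y))
      ≡⟨ sumMap-cong (allVecs a) (λ y → sumMap-*ʳ (allVecs b) (χim Z y) (λ v → δᵛ (Y · v) y)) ⟩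
    sumMap (allVecs a) (λ y → sumMap (allVecs b) (λ v → δᵛ (Y · v) y) * χim Z y)
      ≡⟨ sumMap-cong (allVecs a) (λ y → cong (_* χim Z y)
           (trans (sumMap-cong (allVecs b) (λ v → δ-sym (Vector-decSetoid a) (Y · v) y)) (fibre-size Y y))) ⟩
    sumMap (allVecs a) (λ y → χim Y y * #ker Y * χim Z y)
      ≡⟨ sumMap-cong (allVecs a) χimY-redundant ⟩
    sumMap (allVecs a) (λ y → χim Z y * #ker Y)
      ≡⟨ sumMap-*ʳ (allVecs a) (#ker Y) (χim Z) ⟩
    #im Z * #ker Y ∎
    where
    open ≡-Reasoning
    χimY-redundant : ∀ y → χim Y y * #ker Y * χim Z y ≡ χim Z y * #ker Y
    χimY-redundant y = χim-cases Z y (λ c → χim Y y * #ker Y * c ≡ c * #ker Y)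
      (λ y∈Z → trans (cong (λ c → c * #ker Y * 1) (χim-yes Y (im⊆ y∈Z))) (ℕₚ.*-identityʳ _))
      (λ _ → ℕₚ.*-zeroʳ (χim Y y * #ker Y))

  module _ {a k} (w : Vector F a) (D : Mat a k) where
    private
      target : F → Vector F a
      target t = (-ᶠ t) *ₛ w

      target≡ : ∀ t i → target t i ≡ -ᶠ (w i *ᶠ t)
      target≡ t i = trans (sym (-‿distribˡ-* t (w i))) (cong -ᶠ_ (*-comm t (w i)))

    #ker-∷ᶜ : #ker (w ∷ᶜ D) ≡ sumMap elems (λ t → χim D (target t) * #ker D)
    #ker-∷ᶜ = begin
      #ker (w ∷ᶜ D)
        ≡⟨ sumMap-allFuns-suc elems k _ ⟩
      sumMap elems (λ t → sumMap (allVecs k) (λ x → δᵛ 0ᵛ ((w ∷ᶜ D) · (t Vector.∷ x))))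
        ≡⟨ sumMap-cong elems (λ t → sumMap-cong (allVecs k) (λ x →
             δ-⇔ (Vector-decSetoid a) (Vector-decSetoid a) (kernel≡fibre t x))) ⟩
      sumMap elems (λ t → sumMap (allVecs k) (λ x → δᵛ (target t) (D · x)))
        ≡⟨ sumMap-cong elems (λ t → fibre-size D (target t)) ⟩
      sumMap elems (λ t → χim D (target t) * #ker D) ∎
      where
      open ≡-Reasoning
      kernel≡fibre : ∀ t x → (0ᵛ ≗ (w ∷ᶜ D) · (t Vector.∷ x)) ⇔ (target t ≗ D · x)
      kernel≡fibre t x = mk⇔
        (λ e i → trans (target≡ t i) (sym (+-inverseʳ-unique (w i *ᶠ t) _ (sym (e i)))))
        (λ e i → sym (trans (cong (w i *ᶠ t +ᶠ_) (trans (sym (e i)) (target≡ t i))) (-‿inverseʳ (w i *ᶠ t))))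

    #ker-∷ᶜ-∈im : InImage D w → #ker (w ∷ᶜ D) ≡ q * #ker D
    #ker-∷ᶜ-∈im (x₀ , Dx₀≗w) = begin
      #ker (w ∷ᶜ D)
        ≡⟨ #ker-∷ᶜ ⟩
      sumMap elems (λ t → χim D (target t) * #ker D)
        ≡⟨ sumMap-cong elems (λ t → cong (_* #ker D) (χim-yes D (target-reached t))) ⟩
      sumMap elems (λ _ → 1 * #ker D)
        ≡⟨ sumMap-const elems _ ⟩
      1 * #ker D * q
        ≡⟨ cong (_* q) (ℕₚ.*-identityˡ (#ker D)) ⟩
      #ker D * q
        ≡⟨ ℕₚ.*-comm (#ker D) q ⟩
      q * #ker D ∎
      where
      open ≡-Reasoning
      target-reached : ∀ t → InImage D (target t)
      target-reached t = (-ᶠ t) *ₛ x₀ , λ i → trans (·-*ₛ D (-ᶠ t) x₀ i) (cong ((-ᶠ t) *ᶠ_) (Dx₀≗w i))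

    #ker-∷ᶜ-∉im : ¬ InImage D w → #ker (w ∷ᶜ D) ≡ #ker D
    #ker-∷ᶜ-∉im w∉ = begin
      #ker (w ∷ᶜ D)
        ≡⟨ #ker-∷ᶜ ⟩
      sumMap elems (λ t → χim D (target t) * #ker D)
        ≡⟨ sumMap-cong elems (λ t → cong (_* #ker D) (χim-target t)) ⟩
      sumMap elems (λ t → δ 𝔽-decSetoid 0# t * #ker D)
        ≡⟨ sumMap-δ 𝔽-decSetoid elems elems-enumerates (λ _ → #ker D) (λ _ → refl) 0# ⟩
      #ker D ∎
      where
      open ≡-Reasoning
      -t≢0 : ∀ {t} → 0# ≢ t → -ᶠ t ≢ 0#
      -t≢0 {t} 0≢t -t≡0 = 0≢t (sym (trans (sym (-‿involutive t)) (trans (cong -ᶠ_ -t≡0) -0#≈0#)))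
      rescale : ∀ {t} → 0# ≢ t → InImage D (target t) → InImage D w
      rescale {t} 0≢t (x , Dx≗target) = -t⁻¹ *ₛ x , λ i → begin
        (D · (-t⁻¹ *ₛ x)) i         ≡⟨ ·-*ₛ D -t⁻¹ x i ⟩
        -t⁻¹ *ᶠ (D · x) i          ≡⟨ cong (-t⁻¹ *ᶠ_) (Dx≗target i) ⟩
        -t⁻¹ *ᶠ ((-ᶠ t) *ᶠ w i)     ≡⟨ *-assoc -t⁻¹ (-ᶠ t) (w i) ⟨
        -t⁻¹ *ᶠ (-ᶠ t) *ᶠ w i       ≡⟨ cong (_*ᶠ w i) (trans (*-comm -t⁻¹ (-ᶠ t)) (proj₂ inv)) ⟩
        1# *ᶠ w i                ≡⟨ *-identityˡ (w i) ⟩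
        w i                      ∎
        where
        inv = inverse (-ᶠ t) (-t≢0 0≢t)
        -t⁻¹ = proj₁ inv
      χim-target : ∀ t → χim D (target t) ≡ δ 𝔽-decSetoid 0# t
      χim-target t with 0# ≟ t
      ... | yes refl = χim-yes D (0ᵛ , λ i →
                         trans (·-zero D i) (sym (trans (target≡ 0# i) (trans (cong -ᶠ_ (zeroʳ (w i))) -0#≈0#))))
      ... | no 0≢t   = χim-no D (w∉ ∘ rescale 0≢t)

    #im-∷ᶜ-∈im : InImage D w → #im (w ∷ᶜ D) ≡ #im D
    #im-∷ᶜ-∈im w∈ = ℕₚ.*-cancelʳ-≡ (#im (w ∷ᶜ D)) (#im D) (q * #ker D) {{q*#ker≢0}} (begin
      #im (w ∷ᶜ D) * (q * #ker D)   ≡⟨ cong (#im (w ∷ᶜ D) *_) (#ker-∷ᶜ-∈im w∈) ⟨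
      #im (w ∷ᶜ D) * #ker (w ∷ᶜ D)  ≡⟨ #im*#ker≡q^b (w ∷ᶜ D) ⟩
      q * q ^ k                     ≡⟨ cong (q *_) (#im*#ker≡q^b D) ⟨
      q * (#im D * #ker D)          ≡⟨ ℕ*.x∙yz≈y∙xz q (#im D) (#ker D) ⟩
      #im D * (q * #ker D)          ∎)
      where
      open ≡-Reasoning
      q*#ker≢0 = ℕₚ.m*n≢0 q (#ker D) {{q-nonZero}} {{ℕ.>-nonZero (1≤#ker D)}}

    #im-∷ᶜ-∉im : ¬ InImage D w → #im (w ∷ᶜ D) ≡ q * #im D
    #im-∷ᶜ-∉im w∉ = ℕₚ.*-cancelʳ-≡ (#im (w ∷ᶜ D)) (q * #im D) (#ker D) {{ℕ.>-nonZero (1≤#ker D)}} (begin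
      #im (w ∷ᶜ D) * #ker D         ≡⟨ cong (#im (w ∷ᶜ D) *_) (#ker-∷ᶜ-∉im w∉) ⟨
      #im (w ∷ᶜ D) * #ker (w ∷ᶜ D)  ≡⟨ #im*#ker≡q^b (w ∷ᶜ D) ⟩
      q * q ^ k                     ≡⟨ cong (q *_) (#im*#ker≡q^b D) ⟨
      q * (#im D * #ker D)          ≡⟨ ℕₚ.*-assoc q (#im D) (#ker D) ⟨
      q * #im D * #ker D            ∎)
      where open ≡-Reasoning

-- The rank is the dimension of the image

module Rank (K : FiniteField) where
  open KernelsAndImages K public
  open FF K public using (rank; hasIndepColsᵇ; linIndepᵇ; isZeroVecᵇ; isZeroMatᵇ)

  q^-injective : ∀ {m n} → q ^ m ≡ q ^ n → m ≡ n
  q^-injective {m} {n} q^m≡q^n with ℕₚ.<-cmp m n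
  ... | tri< m<n _ _ = ⊥-elim (ℕₚ.<-irrefl q^m≡q^n (ℕₚ.^-monoʳ-< q 2≤q m<n))
  ... | tri≈ _ m≡n _ = m≡n
  ... | tri> _ _ n<m = ⊥-elim (ℕₚ.<-irrefl (sym q^m≡q^n) (ℕₚ.^-monoʳ-< q 2≤q n<m))

  q^-cancel-≤ : ∀ {m n} → q ^ m ≤ q ^ n → m ≤ n
  q^-cancel-≤ {m} {n} q^m≤q^n = ℕₚ.≮⇒≥ (λ n<m → ℕₚ.<⇒≱ (ℕₚ.^-monoʳ-< q 2≤q n<m) q^m≤q^n)

  columns : ∀ {a b k} → Mat a b → (Fin k → Fin b) → Mat a k
  columns X σ i j = X i (σ j)

  injective-cong : ∀ {a b} {X Y : Mat a b} → X ≋ Y → Injective X → Injective Y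
  injective-cong X≋Y inj x Yx≗0 = inj x (λ i → trans (·-congˡ X≋Y x i) (Yx≗0 i))

  columns-⊆-im : ∀ {a b k} (X : Mat a b) (σ : Fin k → Fin b) c → InImage X (columns X σ · c)
  columns-⊆-im X σ c = selection · c , λ i → trans (sym (⊗-· X selection c i)) (·-congˡ X⊗selection≋columns c i)
    where
    selection : Mat _ _
    selection j t = basis (σ t) j
    X⊗selection≋columns : X ⊗ selection ≋ columns X σ
    X⊗selection≋columns i t = ·-basis X (σ t) i

  T-isZeroVecᵇ : ∀ {n} (v : Vector F n) → T (isZeroVecᵇ v) ⇔ v ≗ 0ᵛ
  T-isZeroVecᵇ {n} v = mk⇔ (λ t i → to (T-does (v i ≟ 0#)) (to (T-allᵇ n _) t i))
                           (λ v≗0 → from (T-allᵇ n _) (λ i → from (T-does (v i ≟ 0#)) (v≗0 i)))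

  T-isZeroMatᵇ : ∀ {a b} (Z : Mat a b) → T (isZeroMatᵇ Z) ⇔ (∀ i j → Z i j ≡ 0#)
  T-isZeroMatᵇ {a} {b} Z = mk⇔
    (λ t i j → to (T-does (Z i j ≟ 0#)) (to (T-allᵇ b _) (to (T-allᵇ a _) t i) j))
    (λ Z≋0 → from (T-allᵇ a _) (λ i → from (T-allᵇ b _) (λ j → from (T-does (Z i j ≟ 0#)) (Z≋0 i j))))

  T-linIndepᵇ : ∀ {a b k} (X : Mat a b) (σ : Fin k → Fin b) →
                T (linIndepᵇ k (λ j i → X i (σ j))) ⇔ Injective (columns X σ)
  T-linIndepᵇ {k = k} X σ = mk⇔ independent⇒injective injective⇒independent
    where
    combination : Vector F k → Vector F _
    combination c i = ∑ k (λ j → c j *ᶠ X i (σ j))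
    combination≗ : ∀ c → combination c ≗ columns X σ · c
    combination≗ c i = ∑-cong k (λ j → *-comm (c j) (X i (σ j)))
    trivial-only : ∀ c → T (not (isZeroVecᵇ (combination c)) ∨ isZeroVecᵇ c) ⇔ (columns X σ · c ≗ 0ᵛ → c ≗ 0ᵛ)
    trivial-only c = mk⇔
      (λ t Xσc≗0 → to (T-isZeroVecᵇ c)
                     (to (T-not-∨ _ _) t (from (T-isZeroVecᵇ _) (λ i → trans (combination≗ c i) (Xσc≗0 i)))))
      (λ h → from (T-not-∨ _ _) (λ t → from (T-isZeroVecᵇ c)
                                      (h (λ i → trans (sym (combination≗ c i)) (to (T-isZeroVecᵇ _) t i)))))
    independent⇒injective : T (linIndepᵇ k (λ j i → X i (σ j))) → Injective (columns X σ)
    independent⇒injective t x Xσx≗0 i = trans (x≗c i) (to (trivial-only c) Tc Xσc≗0 i)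
      where
      x∈ = enumerates⇒any (Vector-decSetoid k) (allVecs k) (allVecs-enumerates k) x
      c  = Any.lookup x∈
      Tc,x≗c = All.lookupAny (to (T-allListᵇ (allVecs k) _) t) x∈
      Tc  = proj₁ Tc,x≗c
      x≗c = proj₂ Tc,x≗c
      Xσc≗0 : columns X σ · c ≗ 0ᵛ
      Xσc≗0 i′ = trans (·-congʳ (columns X σ) (λ j → sym (x≗c j)) i′) (Xσx≗0 i′)
    injective⇒independent : Injective (columns X σ) → T (linIndepᵇ k (λ j i → X i (σ j)))
    injective⇒independent inj =
      from (T-allListᵇ (allVecs k) _) (All.tabulate (λ {c} _ → from (trivial-only c) (inj c)))

  T-hasIndepColsᵇ : ∀ {a b} (X : Mat a b) k → T (hasIndepColsᵇ X k) ⇔ (∃[ σ ] Injective (columns {k = k} X σ))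
  T-hasIndepColsᵇ {b = b} X k = mk⇔
    (λ t → let (σ , Tσ) = Any.satisfied (to (T-anyᵇ (allFuns (allFin b) k) independent?) t)
           in σ , to (T-linIndepᵇ X σ) Tσ)
    (λ (σ , inj) → from (T-anyᵇ (allFuns (allFin b) k) independent?)
      (Any.map (λ σ≗σ′ → from (T-linIndepᵇ X _) (injective-cong (λ i j → cong (X i) (σ≗σ′ j)) inj))
               (enumerates⇒any Selections (allFuns (allFin b) k) all-enumerates σ)))
    where
    independent? : (Fin k → Fin b) → Bool
    independent? σ = linIndepᵇ k (λ j i → X i (σ j))
    Selections : DecSetoid 0ℓ 0ℓ
    Selections = Pointwise.decSetoid (≡.decSetoid Finₚ._≟_) k
    all-enumerates : Enumerates Selections (allFuns (allFin b) k)
    all-enumerates =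
      allFuns-enumerates (≡.decSetoid Finₚ._≟_) (unique-complete⇒enumerates Finₚ._≟_ (allFin⁺ b) ∈-allFin) k

  module _ {a b} (X : Mat a b) where
    private
      candidate : ℕ → ℕ
      candidate k = if hasIndepColsᵇ X k then k else 0

      independent-0 : T (hasIndepColsᵇ X 0)
      independent-0 = from (T-hasIndepColsᵇ X 0) ((λ ()) , λ _ _ ())

    rank≤cols : rank X ≤ b
    rank≤cols = ⊔-foldr-lub candidate (upTo (suc b)) candidate≤b
      where
      candidate≤b : ∀ {k} → k ∈ upTo (suc b) → candidate k ≤ b
      candidate≤b {k} k∈ with hasIndepColsᵇ X k
      ... | true  = ℕₚ.≤-pred (∈-upTo⁻ k∈)
      ... | false = z≤n

    rank-maximal : ∀ {k} (σ : Fin k → Fin b) → k ≤ b → Injective (columns X σ) → k ≤ rank X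
    rank-maximal {k} σ k≤b inj =
      ℕₚ.≤-trans (ℕₚ.≤-reflexive (sym candidate≡k)) (⊔-foldr-ub candidate {k} (∈-upTo⁺ (s≤s k≤b)))
      where
      candidate≡k : candidate k ≡ k
      candidate≡k with hasIndepColsᵇ X k | from (T-hasIndepColsᵇ X k) (σ , inj)
      ... | true | _ = refl

    rank-attained : ∃[ σ ] Injective (columns {k = rank X} X σ)
    rank-attained = to (T-hasIndepColsᵇ X (rank X)) attained
      where
      candidate-attained : ∀ k → T (hasIndepColsᵇ X (candidate k))
      candidate-attained k with hasIndepColsᵇ X k in independent
      ... | true  = subst T (sym independent) tt
      ... | false = independent-0
      attained : T (hasIndepColsᵇ X (rank X))
      attained with foldr-selective ℕₚ.⊔-sel 0 (map candidate (upTo (suc b)))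
      ... | inj₁ rank≡0 = subst (T ∘ hasIndepColsᵇ X) (sym rank≡0) independent-0
      ... | inj₂ rank∈  with ∈-map⁻ candidate {xs = upTo (suc b)} rank∈
      ...   | k , _ , rank≡candidate = subst (T ∘ hasIndepColsᵇ X) (sym rank≡candidate) (candidate-attained k)

    q^rank≡#im : q ^ rank X ≡ #im X
    q^rank≡#im = ℕₚ.≤-antisym q^r≤#im #im≤q^r
      where
      σ   = proj₁ rank-attained
      Xσ  = columns X σ
      inj = proj₂ rank-attained
      #imXσ≡q^r : #im Xσ ≡ q ^ rank X
      #imXσ≡q^r = injective⇒#im≡q^b Xσ inj
      q^r≤#im : q ^ rank X ≤ #im X
      q^r≤#im = subst (_≤ #im X) #imXσ≡q^r (#im-mono Xσ X (columns-⊆-im X σ))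
      #im≤q^r : #im X ≤ q ^ rank X
      #im≤q^r with ℕₚ.m≤n⇒m<n∨m≡n rank≤cols
      ... | inj₂ r≡b = subst (λ e → #im X ≤ q ^ e) (sym r≡b) (#im≤q^b X)
      ... | inj₁ r<b = subst (#im X ≤_) #imXσ≡q^r (#im-mono X Xσ spanned)
        where
        -- A column outside the span of Xσ would extend σ to rank X + 1 independent columns.
        column-spanned : ∀ j → InImage Xσ (λ i → X i j)
        column-spanned j with inImage? Xσ (λ i → X i j)
        ... | yes j∈ = j∈
        ... | no j∉  = ⊥-elim (ℕₚ.<-irrefl refl (rank-maximal (j Vector.∷ σ) r<b extended-injective))
          where
          column : Vector F a
          column i = X i j
          extended-injective : Injective (columns X (j Vector.∷ σ))
          extended-injective =
            injective-cong {X = column ∷ᶜ Xσ} {columns X (j Vector.∷ σ)} (λ i → λ { zero → refl ; (suc t) → refl })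
              (#ker≡1⇒injective (column ∷ᶜ Xσ) (trans (#ker-∷ᶜ-∉im column Xσ j∉) (injective⇒#ker≡1 Xσ inj)))
        coefficients : Mat (rank X) b
        coefficients t j = proj₁ (column-spanned j) t
        spanned : ∀ x → InImage Xσ (X · x)
        spanned x = coefficients · x , λ i →
          trans (sym (⊗-· Xσ coefficients x i)) (·-congˡ (λ i j → proj₂ (column-spanned j) i) x i)

  rank-cong : ∀ {a b} {X Y : Mat a b} → X ≋ Y → rank X ≡ rank Y
  rank-cong {X = X} {Y} X≋Y = q^-injective (trans (q^rank≡#im X) (trans (#im-cong X≋Y) (sym (q^rank≡#im Y))))

  rank≤rows : ∀ {a b} (X : Mat a b) → rank X ≤ a
  rank≤rows X = q^-cancel-≤ (subst (_≤ _) (sym (q^rank≡#im X)) (#im≤q^a X))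

  #ker≡q^[cols∸rank] : ∀ {a b} (X : Mat a b) → #ker X ≡ q ^ (b ∸ rank X)
  #ker≡q^[cols∸rank] {b = b} X = ℕₚ.*-cancelˡ-≡ _ _ (q ^ rank X) {{ℕₚ.m^n≢0 q (rank X)}} (begin
    q ^ rank X * #ker X               ≡⟨ cong (_* #ker X) (q^rank≡#im X) ⟩
    #im X * #ker X                    ≡⟨ #im*#ker≡q^b X ⟩
    q ^ b                             ≡⟨ cong (q ^_) (ℕₚ.m+[n∸m]≡n (rank≤cols X)) ⟨
    q ^ (rank X + (b ∸ rank X))       ≡⟨ ℕₚ.^-distribˡ-+-* q (rank X) _ ⟩
    q ^ rank X * q ^ (b ∸ rank X)     ∎)
    where open ≡-Reasoning

  rank≡0⇔zero : ∀ {a b} (X : Mat a b) → rank X ≡ 0 ⇔ (∀ i j → X i j ≡ 0#)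
  rank≡0⇔zero {a} {b} X = mk⇔ rank≡0⇒zero (λ X≋0 → q^-injective (trans (q^rank≡#im X) (#im-zero X≋0)))
    where
    #im-zero : (∀ i j → X i j ≡ 0#) → #im X ≡ 1
    #im-zero X≋0 = trans (sumMap-cong (allVecs a) χim≡δ) (allVecs-enumerates a 0ᵛ)
      where
      X·≗0 : ∀ x → X · x ≗ 0ᵛ
      X·≗0 x i = trans (∑-cong b (λ j → trans (cong (_*ᶠ x j) (X≋0 i j)) (zeroˡ (x j)))) (∑-zero b)
      χim≡δ : ∀ y → χim X y ≡ δᵛ 0ᵛ y
      χim≡δ y with DecSetoid._≟_ (Vector-decSetoid a) 0ᵛ y
      ... | yes 0≗y = trans (χim-yes X (0ᵛ , λ i → trans (·-zero X i) (0≗y i))) (sym (δ-yes (Vector-decSetoid a) 0≗y))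
      ... | no 0≉y  = trans (χim-no X (λ (x , Xx≗y) → 0≉y (λ i → trans (sym (X·≗0 x i)) (Xx≗y i))))
                            (sym (δ-no (Vector-decSetoid a) 0≉y))
    rank≡0⇒zero : rank X ≡ 0 → ∀ i j → X i j ≡ 0#
    rank≡0⇒zero r≡0 i j with X i j ≟ 0#
    ... | yes Xij≡0 = Xij≡0
    ... | no Xij≢0  = ⊥-elim (ℕₚ.<-irrefl (sym #im≡1)
      (2≤sumMap (Vector-decSetoid a) (allVecs a) (allVecs-enumerates a) (χim X) (χim-cong X) column≉0
                (ℕₚ.≤-reflexive (sym (χim-yes X (basis j , ·-basis X j))))
                (ℕₚ.≤-reflexive (sym (χim-yes X (0ᵛ , ·-zero X))))))
      where
      #im≡1 : #im X ≡ 1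
      #im≡1 = trans (sym (q^rank≡#im X)) (cong (q ^_) r≡0)
      column≉0 : ¬ (λ i′ → X i′ j) ≗ 0ᵛ
      column≉0 col≗0 = Xij≢0 (col≗0 i)

  module _ {a k} (w : Vector F a) (D : Mat a k) where

    rank-∷ᶜ-∈im : InImage D w → rank (w ∷ᶜ D) ≡ rank D
    rank-∷ᶜ-∈im w∈ = q^-injective (trans (q^rank≡#im (w ∷ᶜ D)) (trans (#im-∷ᶜ-∈im w D w∈) (sym (q^rank≡#im D))))

    rank-∷ᶜ-∉im : ¬ InImage D w → rank (w ∷ᶜ D) ≡ suc (rank D)
    rank-∷ᶜ-∉im w∉ =
      q^-injective (trans (q^rank≡#im (w ∷ᶜ D)) (trans (#im-∷ᶜ-∉im w D w∉) (cong (q *_) (sym (q^rank≡#im D)))))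

  #orthogonal : ∀ {n} → Vector F n → ℕ
  #orthogonal {n} u = sumMap (allVecs n) (λ x → δ 𝔽-decSetoid 0# (u ∙ x))

  #im-Row : ∀ {n} (u : Vector F n) → ¬ u ≗ 0ᵛ → #im (Row u) ≡ q
  #im-Row {n} u u≉0 = begin
    #im (Row u)                   ≡⟨ sumMap-cong (allVecs 1) (λ y → χim-yes (Row u) (surjective y)) ⟩
    sumMap (allVecs 1) (λ _ → 1)  ≡⟨ length≡sumMap (allVecs 1) ⟨
    length (allVecs 1)            ≡⟨ length-allVecs 1 ⟩
    q * 1                         ≡⟨ ℕₚ.*-identityʳ q ⟩
    q                             ∎
    where
    open ≡-Reasoning
    nonzero-entry = Finₚ.¬∀⟶∃¬ n (λ i → u i ≡ 0#) (λ i → u i ≟ 0#) u≉0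
    j      = proj₁ nonzero-entry
    inv    = inverse (u j) (proj₂ nonzero-entry)
    uⱼ⁻¹   = proj₁ inv
    surjective : ∀ y → InImage (Row u) y
    surjective y = (y zero *ᶠ uⱼ⁻¹) *ₛ basis j , λ { zero → begin
      (Row u · ((y zero *ᶠ uⱼ⁻¹) *ₛ basis j)) zero
        ≡⟨ ·-*ₛ (Row u) (y zero *ᶠ uⱼ⁻¹) (basis j) zero ⟩
      y zero *ᶠ uⱼ⁻¹ *ᶠ (Row u · basis j) zero
        ≡⟨ cong (y zero *ᶠ uⱼ⁻¹ *ᶠ_) (·-basis (Row u) j zero) ⟩
      y zero *ᶠ uⱼ⁻¹ *ᶠ u j
        ≡⟨ *-assoc (y zero) uⱼ⁻¹ (u j) ⟩
      y zero *ᶠ (uⱼ⁻¹ *ᶠ u j)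
        ≡⟨ cong (y zero *ᶠ_) (trans (*-comm uⱼ⁻¹ (u j)) (proj₂ inv)) ⟩
      y zero *ᶠ 1#
        ≡⟨ *-identityʳ (y zero) ⟩
      y zero ∎ }

  -- #orthogonal u is q ^ n for u = 0 and q ^ (n - 1) otherwise; stated without subtraction.
  #orthogonal-formula : ∀ {n} (u : Vector F n) →
                        q * #orthogonal u + δᵛ 0ᵛ u * q ^ n ≡ q ^ n + q * (δᵛ 0ᵛ u * q ^ n)
  #orthogonal-formula {n} u with DecSetoid._≟_ (Vector-decSetoid n) 0ᵛ u
  ... | yes 0≗u = begin
    q * #orthogonal u + δᵛ 0ᵛ u * q ^ n
      ≡⟨ cong₂ (λ o d → q * o + d * q ^ n) all-orthogonal (δ-yes (Vector-decSetoid n) 0≗u) ⟩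
    q * q ^ n + 1 * q ^ n
      ≡⟨ rearrange q (q ^ n) ⟩
    q ^ n + q * (1 * q ^ n)
      ≡⟨ cong (λ d → q ^ n + q * (d * q ^ n)) (δ-yes (Vector-decSetoid n) 0≗u) ⟨
    q ^ n + q * (δᵛ 0ᵛ u * q ^ n) ∎
    where
    open ≡-Reasoning
    rearrange : ∀ k x → k * x + 1 * x ≡ x + k * (1 * x)
    rearrange = solve-∀
    all-orthogonal : #orthogonal u ≡ q ^ n
    all-orthogonal = begin
      #orthogonal u
        ≡⟨ sumMap-cong (allVecs n) (λ x → δ-yes 𝔽-decSetoid
             (sym (trans (∑-cong n (λ i → trans (cong (_*ᶠ x i) (sym (0≗u i))) (zeroˡ (x i)))) (∑-zero n)))) ⟩
      sumMap (allVecs n) (λ _ → 1)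
        ≡⟨ length≡sumMap (allVecs n) ⟨
      length (allVecs n)
        ≡⟨ length-allVecs n ⟩
      q ^ n ∎
  ... | no 0≉u = begin
    q * #orthogonal u + δᵛ 0ᵛ u * q ^ n
      ≡⟨ cong (λ d → q * #orthogonal u + d * q ^ n) (δ-no (Vector-decSetoid n) 0≉u) ⟩
    q * #orthogonal u + 0
      ≡⟨ ℕₚ.+-identityʳ _ ⟩
    q * #orthogonal u
      ≡⟨ cong₂ _*_ (#im-Row u (λ u≗0 → 0≉u (λ i → sym (u≗0 i)))) (sym #orthogonal≡#ker) ⟨
    #im (Row u) * #ker (Row u)
      ≡⟨ #im*#ker≡q^b (Row u) ⟩
    q ^ n
      ≡⟨ trans (cong (q ^ n +_) (ℕₚ.*-zeroʳ q)) (ℕₚ.+-identityʳ (q ^ n)) ⟨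
    q ^ n + q * 0
      ≡⟨ cong (λ d → q ^ n + q * (d * q ^ n)) (δ-no (Vector-decSetoid n) 0≉u) ⟨
    q ^ n + q * (δᵛ 0ᵛ u * q ^ n) ∎
    where
    open ≡-Reasoning
    #orthogonal≡#ker : #orthogonal u ≡ #ker (Row u)
    #orthogonal≡#ker = sumMap-cong (allVecs n) (λ x → δ-⇔ 𝔽-decSetoid (Vector-decSetoid 1) {u = 0ᵛ} {Row u · x}
                                                         (mk⇔ (λ e → λ { zero → e }) (λ h → h zero)))

  sumMap-#orthogonal : ∀ {m n} (Y : Mat n m) →
    q * sumMap (allVecs m) (λ v → #orthogonal (Y · v)) + #ker Y * q ^ n ≡ q ^ n * q ^ m + q * (#ker Y * q ^ n)
  sumMap-#orthogonal {m} {n} Y = begin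
    q * sumMap (allVecs m) o + #ker Y * q ^ n
      ≡⟨ cong₂ _+_ (sumMap-*ˡ (allVecs m) q o) (sumMap-*ʳ (allVecs m) (q ^ n) _) ⟨
    sumMap (allVecs m) (λ v → q * o v) + sumMap (allVecs m) (λ v → z v * q ^ n)
      ≡⟨ sumMap-+ (allVecs m) _ _ ⟨
    sumMap (allVecs m) (λ v → q * o v + z v * q ^ n)
      ≡⟨ sumMap-cong (allVecs m) (λ v → #orthogonal-formula (Y · v)) ⟩
    sumMap (allVecs m) (λ v → q ^ n + q * (z v * q ^ n))
      ≡⟨ sumMap-+ (allVecs m) _ _ ⟩
    sumMap (allVecs m) (λ _ → q ^ n) + sumMap (allVecs m) (λ v → q * (z v * q ^ n))
      ≡⟨ cong₂ _+_ (trans (sumMap-const (allVecs m) (q ^ n)) (cong (q ^ n *_) (length-allVecs m)))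
                   (trans (sumMap-*ˡ (allVecs m) q _) (cong (q *_) (sumMap-*ʳ (allVecs m) (q ^ n) z))) ⟩
    q ^ n * q ^ m + q * (#ker Y * q ^ n) ∎
    where
    open ≡-Reasoning
    o z : Vector F m → ℕ
    o v = #orthogonal (Y · v)
    z v = δᵛ 0ᵛ (Y · v)

  -- Both sides solve q * P + A = q ^ a * q ^ b + q * A, where P counts the pairs (x , y) with
  -- y ∙ (X · x) = 0; the solution is unique because q ≠ 1.
  #ker-duality : ∀ {a b} (X : Mat a b) → #ker X * q ^ a ≡ #ker (X ᵀ) * q ^ b
  #ker-duality {a} {b} X = sym (cancel q 2≤q
    (trans (cong (λ P → q * P + #ker (X ᵀ) * q ^ b) orthogonal-pairs)
           (trans (sumMap-#orthogonal (X ᵀ)) (cong (_+ q * (#ker (X ᵀ) * q ^ b)) (ℕₚ.*-comm (q ^ b) (q ^ a)))))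
    (sumMap-#orthogonal X))
    where
    orthogonal-pairs :
      sumMap (allVecs b) (λ x → #orthogonal (X · x)) ≡ sumMap (allVecs a) (λ y → #orthogonal (X ᵀ · y))
    orthogonal-pairs = begin
      sumMap (allVecs b) (λ x → sumMap (allVecs a) (λ y → δ 𝔽-decSetoid 0# ((X · x) ∙ y)))
        ≡⟨ sumMap-cong (allVecs b) (λ x → sumMap-cong (allVecs a) (λ y →
             cong (δ 𝔽-decSetoid 0#) (trans (∙-comm (X · x) y) (∙-· X y x)))) ⟩
      sumMap (allVecs b) (λ x → sumMap (allVecs a) (λ y → δ 𝔽-decSetoid 0# ((X ᵀ · y) ∙ x)))
        ≡⟨ sumMap-swap (allVecs b) (allVecs a) _ ⟩
      sumMap (allVecs a) (λ y → sumMap (allVecs b) (λ x → δ 𝔽-decSetoid 0# ((X ᵀ · y) ∙ x))) ∎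
      where open ≡-Reasoning
    cancel : ∀ k → 2 ≤ k → ∀ {P A B C} → k * P + A ≡ C + k * A → k * P + B ≡ C + k * B → A ≡ B
    cancel (suc k′) (s≤s (s≤s _)) {P} {A} {B} {C} eqA eqB =
      ℕₚ.*-cancelˡ-≡ A B k′ (sym (ℕₚ.+-cancelˡ-≡ (suc k′ * P + A + B) _ _ (begin
        suc k′ * P + A + B + k′ * B        ≡⟨ rearrange₁ (suc k′) P A B k′ ⟩
        (suc k′ * P + A) + suc k′ * B      ≡⟨ cong (_+ suc k′ * B) eqA ⟩
        C + suc k′ * A + suc k′ * B        ≡⟨ rearrange₂ C (suc k′ * A) (suc k′ * B) ⟩
        C + suc k′ * B + suc k′ * A        ≡⟨ cong (_+ suc k′ * A) eqB ⟨
        (suc k′ * P + B) + suc k′ * A      ≡⟨ rearrange₃ (suc k′) P A B k′ ⟩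
        suc k′ * P + A + B + k′ * A        ∎)))
      where
      open ≡-Reasoning
      rearrange₁ : ∀ k P A B k′ → k * P + A + B + k′ * B ≡ (k * P + A) + (B + k′ * B)
      rearrange₁ = solve-∀
      rearrange₂ : ∀ C x y → C + x + y ≡ C + y + x
      rearrange₂ = solve-∀
      rearrange₃ : ∀ k P A B k′ → (k * P + B) + (A + k′ * A) ≡ k * P + A + B + k′ * A
      rearrange₃ = solve-∀

  rank-ᵀ : ∀ {a b} (X : Mat a b) → rank (X ᵀ) ≡ rank X
  rank-ᵀ {a} {b} X = q^-injective (ℕₚ.*-cancelʳ-≡ _ _ (κ * κᵀ) {{κ*κᵀ≢0}} (begin
    q ^ rank (X ᵀ) * (κ * κᵀ)       ≡⟨ ℕ*.x∙yz≈y∙xz (q ^ rank (X ᵀ)) κ κᵀ ⟩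
    κ * (q ^ rank (X ᵀ) * κᵀ)       ≡⟨ cong (λ i → κ * (i * κᵀ)) (q^rank≡#im (X ᵀ)) ⟩
    κ * (#im (X ᵀ) * κᵀ)            ≡⟨ cong (κ *_) (#im*#ker≡q^b (X ᵀ)) ⟩
    κ * q ^ a                       ≡⟨ #ker-duality X ⟩
    κᵀ * q ^ b                      ≡⟨ cong (κᵀ *_) (#im*#ker≡q^b X) ⟨
    κᵀ * (#im X * κ)                ≡⟨ cong (λ i → κᵀ * (i * κ)) (q^rank≡#im X) ⟨
    κᵀ * (q ^ rank X * κ)           ≡⟨ ℕ*.x∙yz≈y∙xz κᵀ (q ^ rank X) κ ⟩
    q ^ rank X * (κᵀ * κ)           ≡⟨ cong (q ^ rank X *_) (ℕₚ.*-comm κᵀ κ) ⟩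
    q ^ rank X * (κ * κᵀ)           ∎))
    where
    open ≡-Reasoning
    κ κᵀ : ℕ
    κ  = #ker X
    κᵀ = #ker (X ᵀ)
    κ*κᵀ≢0 = ℕₚ.m*n≢0 κ κᵀ {{ℕ.>-nonZero (1≤#ker X)}} {{ℕ.>-nonZero (1≤#ker (X ᵀ))}}

-- Counting matrices by rank

module RankCounts (K : FiniteField) where
  open Rank K public
  open FF K public using (#Rank)

  sumMap-ᵀ : ∀ a b (h : Mat a b → ℕ) → Congruent _≋_ _≡_ h →
             sumMap (allMats a b) h ≡ sumMap (allMats b a) (h ∘ _ᵀ)
  sumMap-ᵀ a b h h-cong = trans
    (sumMap-enumeration-invariant (Mat-decSetoid a b) {allMats a b} {map _ᵀ (allMats b a)} (allMats-enumerates a b) transposes h h-cong)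
    (sumMap-map _ᵀ (allMats b a) h)
    where
    transposes : Enumerates (Mat-decSetoid a b) (map _ᵀ (allMats b a))
    transposes = map-enumerates (Mat-decSetoid b a) (Mat-decSetoid a b) _ᵀ _ᵀ (λ e i j → e j i) (λ e i j → e j i)
                   (λ _ _ _ → refl) (λ _ _ _ → refl) {allMats b a} (allMats-enumerates b a)

  sumMap-∷ᶜ : ∀ b ℓ (h : Mat b (suc ℓ) → ℕ) → Congruent _≋_ _≡_ h →
    sumMap (allMats b (suc ℓ)) h ≡ sumMap (allMats b ℓ) (λ C → sumMap (allVecs b) (λ v → h (v ∷ᶜ C)))
  sumMap-∷ᶜ b ℓ h h-cong = begin
    sumMap (allMats b (suc ℓ)) h
      ≡⟨ sumMap-enumeration-invariant (Mat-decSetoid b (suc ℓ)) {allMats b (suc ℓ)} {map prepend pairs}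
                                        (allMats-enumerates b (suc ℓ)) prepended h h-cong ⟩
    sumMap (map prepend pairs) h
      ≡⟨ sumMap-map prepend pairs h ⟩
    sumMap pairs (h ∘ prepend)
      ≡⟨ sumMap-cartesianProduct (allMats b ℓ) (allVecs b) (h ∘ prepend) ⟩
    sumMap (allMats b ℓ) (λ C → sumMap (allVecs b) (λ v → h (v ∷ᶜ C))) ∎
    where
    open ≡-Reasoning
    Pairs-decSetoid : DecSetoid 0ℓ 0ℓ
    Pairs-decSetoid = ×.×-decSetoid (Mat-decSetoid b ℓ) (Vector-decSetoid b)
    pairs : List (Mat b ℓ × Vector F b)
    pairs = cartesianProduct (allMats b ℓ) (allVecs b)
    prepend : Mat b ℓ × Vector F b → Mat b (suc ℓ)
    prepend (C , v) = v ∷ᶜ C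
    split : Mat b (suc ℓ) → Mat b ℓ × Vector F b
    split C′ = (λ i j → C′ i (suc j)) , (λ i → C′ i zero)
    prepended : Enumerates (Mat-decSetoid b (suc ℓ)) (map prepend pairs)
    prepended = map-enumerates Pairs-decSetoid (Mat-decSetoid b (suc ℓ)) prepend split
      (λ { (C≋ , v≗) i zero → v≗ i ; (C≋ , v≗) i (suc j) → C≋ i j })
      (λ C′≋ → (λ i j → C′≋ i (suc j)) , (λ i → C′≋ i zero))
      (λ _ → (λ _ _ → refl) , (λ _ → refl))
      (λ { _ i zero → refl ; _ i (suc j) → refl })
      {pairs} (cartesianProduct-enumerates (Mat-decSetoid b ℓ) (Vector-decSetoid b) {allMats b ℓ} {allVecs b}
                                          (allMats-enumerates b ℓ) (allVecs-enumerates b))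

  sumMap-allMats-no-cols : ∀ a (h : Mat a 0 → ℕ) {c} → (∀ C → h C ≡ c) → sumMap (allMats a 0) h ≡ c
  sumMap-allMats-no-cols a h {c} h≡c = begin
    sumMap (allMats a 0) h
      ≡⟨ sumMap-cong (allMats a 0) h≡c ⟩
    sumMap (allMats a 0) (λ _ → c)
      ≡⟨ sumMap-const (allMats a 0) c ⟩
    c * length (allMats a 0)
      ≡⟨ cong (c *_) (trans (length-allFuns (allVecs 0) a) (cong (_^ a) (length-allVecs 0))) ⟩
    c * (1 ^ a)
      ≡⟨ cong (c *_) (ℕₚ.^-zeroˡ a) ⟩
    c * 1
      ≡⟨ ℕₚ.*-identityʳ c ⟩
    c ∎
    where open ≡-Reasoning

  rank-congruent : ∀ {a b} r → Congruent _≋_ _≡_ (λ (X : Mat a b) → δℕ (rank X) r)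
  rank-congruent r X≋Y = cong (λ ρ → δℕ ρ r) (rank-cong X≋Y)

  #Rank≡sumMap : ∀ a b r → #Rank a b r ≡ sumMap (allMats a b) (λ X → δℕ (rank X) r)
  #Rank≡sumMap a b r = count≡sumMap (allMats a b) (λ X → rank X ℕ.≡ᵇ r)

  #Rank-ᵀ : ∀ a b r → #Rank a b r ≡ #Rank b a r
  #Rank-ᵀ a b r = begin
    #Rank a b r
      ≡⟨ #Rank≡sumMap a b r ⟩
    sumMap (allMats a b) (λ X → δℕ (rank X) r)
      ≡⟨ sumMap-ᵀ a b _ (rank-congruent r) ⟩
    sumMap (allMats b a) (λ X → δℕ (rank (X ᵀ)) r)
      ≡⟨ sumMap-cong (allMats b a) (λ X → cong (λ ρ → δℕ ρ r) (rank-ᵀ X)) ⟩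
    sumMap (allMats b a) (λ X → δℕ (rank X) r)
      ≡⟨ #Rank≡sumMap b a r ⟨
    #Rank b a r ∎
    where open ≡-Reasoning

  #Rank-no-cols : ∀ a r → #Rank a 0 r ≡ δℕ 0 r
  #Rank-no-cols a r = trans (#Rank≡sumMap a 0 r)
    (sumMap-allMats-no-cols a _ (λ X → cong (λ ρ → δℕ ρ r) (ℕₚ.n≤0⇒n≡0 (rank≤cols X))))

  #Rank-cols< : ∀ a b r → b < r → #Rank a b r ≡ 0
  #Rank-cols< a b r b<r = trans (#Rank≡sumMap a b r) (trans
    (sumMap-cong (allMats a b) (λ X → δℕ-no (λ rank≡r → ℕₚ.<⇒≱ b<r (subst (_≤ b) rank≡r (rank≤cols X)))))
    (sumMap-zero (allMats a b)))

  #Rank-rows< : ∀ a b r → a < r → #Rank a b r ≡ 0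
  #Rank-rows< a b r a<r = trans (#Rank-ᵀ a b r) (#Rank-cols< b a r a<r)

  sumMap-rank-∷ᶜ : ∀ {a ℓ} (D : Mat a ℓ) (h : ℕ → ℕ) →
    sumMap (allVecs a) (λ v → h (rank (v ∷ᶜ D))) ≡ q ^ rank D * h (rank D) + (q ^ a ∸ q ^ rank D) * h (suc (rank D))
  sumMap-rank-∷ᶜ {a} D h = begin
    sumMap (allVecs a) (λ v → h (rank (v ∷ᶜ D)))
      ≡⟨ sumMap-nested-split (allVecs a) (λ _ → 0) (χim D) _ (h ρ) (h (suc ρ)) (λ _ → z≤n) (χim≤1 D) by-image ⟩
    (#im D ∸ sumMap (allVecs a) (λ _ → 0)) * h ρ + (length (allVecs a) ∸ #im D) * h (suc ρ)
      ≡⟨ cong₂ (λ z l → (#im D ∸ z) * h ρ + (l ∸ #im D) * h (suc ρ)) (sumMap-zero (allVecs a)) (length-allVecs a) ⟩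
    #im D * h ρ + (q ^ a ∸ #im D) * h (suc ρ)
      ≡⟨ cong (λ i → i * h ρ + (q ^ a ∸ i) * h (suc ρ)) (q^rank≡#im D) ⟨
    q ^ ρ * h ρ + (q ^ a ∸ q ^ ρ) * h (suc ρ) ∎
    where
    open ≡-Reasoning
    ρ : ℕ
    ρ = rank D
    by-image : ∀ v → h (rank (v ∷ᶜ D)) ≡ (χim D v ∸ 0) * h ρ + (1 ∸ χim D v) * h (suc ρ)
    by-image v = χim-cases D v (λ c → h (rank (v ∷ᶜ D)) ≡ (c ∸ 0) * h ρ + (1 ∸ c) * h (suc ρ))
      (λ v∈ → trans (cong h (rank-∷ᶜ-∈im v D v∈)) (sym (trans (ℕₚ.+-identityʳ _) (ℕₚ.+-identityʳ _))))
      (λ v∉ → trans (cong h (rank-∷ᶜ-∉im v D v∉)) (sym (ℕₚ.+-identityʳ _)))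

  #Rank-∷ᶜ : ∀ a ℓ r → #Rank a (suc ℓ) r ≡
    #Rank a ℓ r * q ^ r + sumMap (allMats a ℓ) (λ D → (q ^ a ∸ q ^ rank D) * δℕ (suc (rank D)) r)
  #Rank-∷ᶜ a ℓ r = begin
    #Rank a (suc ℓ) r
      ≡⟨ #Rank≡sumMap a (suc ℓ) r ⟩
    sumMap (allMats a (suc ℓ)) (λ X → δℕ (rank X) r)
      ≡⟨ sumMap-∷ᶜ a ℓ _ (rank-congruent r) ⟩
    sumMap (allMats a ℓ) (λ D → sumMap (allVecs a) (λ v → δℕ (rank (v ∷ᶜ D)) r))
      ≡⟨ sumMap-cong (allMats a ℓ) (λ D → sumMap-rank-∷ᶜ D (λ ρ → δℕ ρ r)) ⟩
    sumMap (allMats a ℓ) (λ D → q ^ rank D * δℕ (rank D) r + (q ^ a ∸ q ^ rank D) * δℕ (suc (rank D)) r)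
      ≡⟨ sumMap-+ (allMats a ℓ) _ _ ⟩
    sumMap (allMats a ℓ) (λ D → q ^ rank D * δℕ (rank D) r) + rest
      ≡⟨ cong (_+ rest) (sumMap-cong (allMats a ℓ) (λ D →
           trans (ℕₚ.*-comm (q ^ rank D) _) (δℕ*-subst (q ^_) (rank D) r))) ⟩
    sumMap (allMats a ℓ) (λ D → δℕ (rank D) r * q ^ r) + rest
      ≡⟨ cong (_+ rest) (trans (sumMap-*ʳ (allMats a ℓ) (q ^ r) _) (cong (_* q ^ r) (sym (#Rank≡sumMap a ℓ r)))) ⟩
    #Rank a ℓ r * q ^ r + rest ∎
    where
    open ≡-Reasoning
    rest : ℕ
    rest = sumMap (allMats a ℓ) (λ D → (q ^ a ∸ q ^ rank D) * δℕ (suc (rank D)) r)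

  #Rank-∷ᶜ-zero : ∀ a ℓ → #Rank a (suc ℓ) 0 ≡ #Rank a ℓ 0
  #Rank-∷ᶜ-zero a ℓ = begin
    #Rank a (suc ℓ) 0
      ≡⟨ #Rank-∷ᶜ a ℓ 0 ⟩
    #Rank a ℓ 0 * 1 + sumMap (allMats a ℓ) (λ D → (q ^ a ∸ q ^ rank D) * 0)
      ≡⟨ cong₂ _+_ (ℕₚ.*-identityʳ _) (trans (sumMap-cong (allMats a ℓ) (λ D → ℕₚ.*-zeroʳ (q ^ a ∸ q ^ rank D)))
                                             (sumMap-zero (allMats a ℓ))) ⟩
    #Rank a ℓ 0 + 0
      ≡⟨ ℕₚ.+-identityʳ _ ⟩
    #Rank a ℓ 0 ∎
    where open ≡-Reasoning

  #Rank-∷ᶜ-suc : ∀ a ℓ r →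
    #Rank a (suc ℓ) (suc r) ≡ #Rank a ℓ (suc r) * q ^ suc r + #Rank a ℓ r * (q ^ a ∸ q ^ r)
  #Rank-∷ᶜ-suc a ℓ r = trans (#Rank-∷ᶜ a ℓ (suc r)) (cong (#Rank a ℓ (suc r) * q ^ suc r +_) (begin
    sumMap (allMats a ℓ) (λ D → (q ^ a ∸ q ^ rank D) * δℕ (rank D) r)
      ≡⟨ sumMap-cong (allMats a ℓ) (λ D →
           trans (ℕₚ.*-comm _ (δℕ (rank D) r)) (δℕ*-subst (λ ρ → q ^ a ∸ q ^ ρ) (rank D) r)) ⟩
    sumMap (allMats a ℓ) (λ D → δℕ (rank D) r * (q ^ a ∸ q ^ r))
      ≡⟨ sumMap-*ʳ (allMats a ℓ) _ _ ⟩
    sumMap (allMats a ℓ) (λ D → δℕ (rank D) r) * (q ^ a ∸ q ^ r)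
      ≡⟨ cong (_* (q ^ a ∸ q ^ r)) (#Rank≡sumMap a ℓ r) ⟨
    #Rank a ℓ r * (q ^ a ∸ q ^ r) ∎))
    where open ≡-Reasoning

  #Rank-rank-zero : ∀ a b → #Rank a b 0 ≡ 1
  #Rank-rank-zero a zero    = #Rank-no-cols a 0
  #Rank-rank-zero a (suc b) = trans (#Rank-∷ᶜ-zero a b) (#Rank-rank-zero a b)

  #frames : ℕ → ℕ → ℕ
  #frames d zero    = 1
  #frames d (suc k) = #frames d k * (q ^ d ∸ q ^ k)

  module _ {a b} (Y : Mat a b) where

    fullWithRank : ∀ {ℓ} → ℕ → Mat b ℓ → ℕ
    fullWithRank {ℓ} r C = δℕ (rank C) ℓ * δℕ (rank (Y ⊗ C)) r

    #FullRank⊗ : ℕ → ℕ → ℕ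
    #FullRank⊗ ℓ r = sumMap (allMats b ℓ) (fullWithRank r)

    sumMap-FullRank⊗-∷ᶜ : ∀ {ℓ} (C : Mat b ℓ) r →
      sumMap (allVecs b) (λ v → fullWithRank r (v ∷ᶜ C))
      ≡ (q ^ r * #ker Y ∸ q ^ ℓ) * fullWithRank r C
        + (q ^ b ∸ q ^ rank (Y ⊗ C) * #ker Y) * (δℕ (rank C) ℓ * δℕ (suc (rank (Y ⊗ C))) r)
    sumMap-FullRank⊗-∷ᶜ {ℓ} C r = begin
      sumMap (allVecs b) f
        ≡⟨ sumMap-nested-split (allVecs b) u w f m n u≤w (λ v → χim≤1 (Y ⊗ C) (Y · v)) by-images ⟩
      (sumMap (allVecs b) w ∸ #im C) * m + (length (allVecs b) ∸ sumMap (allVecs b) w) * n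
        ≡⟨ cong₂ (λ W l → (W ∸ #im C) * m + (l ∸ W) * n) (sumMap-χim-· Y (Y ⊗ C) image⊆) (length-allVecs b) ⟩
      (#im (Y ⊗ C) * #ker Y ∸ #im C) * m + (q ^ b ∸ #im (Y ⊗ C) * #ker Y) * n
        ≡⟨ cong₂ (λ i j → (i * #ker Y ∸ j) * m + (q ^ b ∸ i * #ker Y) * n) (q^rank≡#im (Y ⊗ C)) (q^rank≡#im C) ⟨
      (q ^ ρ * #ker Y ∸ q ^ rank C) * m + (q ^ b ∸ q ^ ρ * #ker Y) * n
        ≡⟨ cong (_+ (q ^ b ∸ q ^ ρ * #ker Y) * n) (δℕ²*-subst (λ x y → q ^ y * #ker Y ∸ q ^ x) (rank C) ℓ ρ r) ⟩
      (q ^ r * #ker Y ∸ q ^ ℓ) * m + (q ^ b ∸ q ^ ρ * #ker Y) * n ∎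
      where
      open ≡-Reasoning
      ρ : ℕ
      ρ = rank (Y ⊗ C)
      f u w : Vector F b → ℕ
      f v = fullWithRank r (v ∷ᶜ C)
      u   = χim C
      w v = χim (Y ⊗ C) (Y · v)
      m n : ℕ
      m = δℕ (rank C) ℓ * δℕ ρ r
      n = δℕ (rank C) ℓ * δℕ (suc ρ) r
      image⊆ : ∀ {y} → InImage (Y ⊗ C) y → InImage Y y
      image⊆ (x , YCx≗y) = C · x , λ i → trans (sym (⊗-· Y C x i)) (YCx≗y i)
      mapped : ∀ {v} → InImage C v → InImage (Y ⊗ C) (Y · v)
      mapped (x , Cx≗v) = x , λ i → trans (⊗-· Y C x i) (·-congʳ Y Cx≗v i)
      u≤w : ∀ v → u v ≤ w v
      u≤w v = ⟦does⟧-mono (inImage? C v) (inImage? (Y ⊗ C) (Y · v)) mapped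
      rank-Y⊗∷ᶜ : ∀ v → rank (Y ⊗ (v ∷ᶜ C)) ≡ rank ((Y · v) ∷ᶜ (Y ⊗ C))
      rank-Y⊗∷ᶜ v = rank-cong (⊗-∷ᶜ Y v C)
      by-images : ∀ v → f v ≡ (w v ∸ u v) * m + (1 ∸ w v) * n
      by-images v = χim-cases C v (λ c → f v ≡ (w v ∸ c) * m + (1 ∸ w v) * n)
        (λ v∈ → trans (trans (cong (λ ρ₁ → δℕ ρ₁ (suc ℓ) * δℕ (rank (Y ⊗ (v ∷ᶜ C))) r) (rank-∷ᶜ-∈im v C v∈))
                             (cong (_* δℕ (rank (Y ⊗ (v ∷ᶜ C))) r)
                                   (δℕ-no (λ rank≡ → ℕₚ.<-irrefl rank≡ (s≤s (rank≤cols C))))))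
                      (cong (λ c → (c ∸ 1) * m + (1 ∸ c) * n) (sym (χim-yes (Y ⊗ C) (mapped v∈)))))
        (λ v∉ → χim-cases (Y ⊗ C) (Y · v) (λ c → f v ≡ (c ∸ 0) * m + (1 ∸ c) * n)
          (λ Yv∈ → trans (cong₂ (λ ρ₁ ρ₂ → δℕ ρ₁ (suc ℓ) * δℕ ρ₂ r) (rank-∷ᶜ-∉im v C v∉)
                                 (trans (rank-Y⊗∷ᶜ v) (rank-∷ᶜ-∈im (Y · v) (Y ⊗ C) Yv∈)))
                         (sym (trans (ℕₚ.+-identityʳ _) (ℕₚ.+-identityʳ m))))
          (λ Yv∉ → trans (cong₂ (λ ρ₁ ρ₂ → δℕ ρ₁ (suc ℓ) * δℕ ρ₂ r) (rank-∷ᶜ-∉im v C v∉)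
                                 (trans (rank-Y⊗∷ᶜ v) (rank-∷ᶜ-∉im (Y · v) (Y ⊗ C) Yv∉)))
                         (sym (ℕₚ.+-identityʳ n))))

    fullWithRank-congruent : ∀ ℓ r → Congruent _≋_ _≡_ (fullWithRank {ℓ} r)
    fullWithRank-congruent ℓ r C≋C′ =
      cong₂ (λ ρ₁ ρ₂ → δℕ ρ₁ ℓ * δℕ ρ₂ r) (rank-cong C≋C′) (rank-cong (⊗-cong {A = Y} (λ _ _ → refl) C≋C′))

    #FullRank⊗-∷ᶜ : ∀ ℓ r → #FullRank⊗ (suc ℓ) r ≡ (q ^ r * #ker Y ∸ q ^ ℓ) * #FullRank⊗ ℓ r
      + sumMap (allMats b ℓ) (λ C → (q ^ b ∸ q ^ rank (Y ⊗ C) * #ker Y) * (δℕ (rank C) ℓ * δℕ (suc (rank (Y ⊗ C))) r))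
    #FullRank⊗-∷ᶜ ℓ r = begin
      #FullRank⊗ (suc ℓ) r
        ≡⟨ sumMap-∷ᶜ b ℓ _ (fullWithRank-congruent (suc ℓ) r) ⟩
      sumMap (allMats b ℓ) (λ C → sumMap (allVecs b) (λ v → fullWithRank r (v ∷ᶜ C)))
        ≡⟨ sumMap-cong (allMats b ℓ) (λ C → sumMap-FullRank⊗-∷ᶜ C r) ⟩
      sumMap (allMats b ℓ) (λ C → (q ^ r * #ker Y ∸ q ^ ℓ) * fullWithRank r C + new-rank C)
        ≡⟨ sumMap-+ (allMats b ℓ) _ new-rank ⟩
      sumMap (allMats b ℓ) (λ C → (q ^ r * #ker Y ∸ q ^ ℓ) * fullWithRank r C) + sumMap (allMats b ℓ) new-rank
        ≡⟨ cong (_+ sumMap (allMats b ℓ) new-rank) (sumMap-*ˡ (allMats b ℓ) (q ^ r * #ker Y ∸ q ^ ℓ) (fullWithRank r)) ⟩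
      (q ^ r * #ker Y ∸ q ^ ℓ) * #FullRank⊗ ℓ r + sumMap (allMats b ℓ) new-rank ∎
      where
      open ≡-Reasoning
      new-rank : Mat b ℓ → ℕ
      new-rank C = (q ^ b ∸ q ^ rank (Y ⊗ C) * #ker Y) * (δℕ (rank C) ℓ * δℕ (suc (rank (Y ⊗ C))) r)

    #FullRank⊗-∷ᶜ-zero : ∀ ℓ → #FullRank⊗ (suc ℓ) 0 ≡ (q ^ 0 * #ker Y ∸ q ^ ℓ) * #FullRank⊗ ℓ 0
    #FullRank⊗-∷ᶜ-zero ℓ = trans (#FullRank⊗-∷ᶜ ℓ 0) (trans (cong (leading +_) no-new-rank) (ℕₚ.+-identityʳ leading))
      where
      leading : ℕ
      leading = (q ^ 0 * #ker Y ∸ q ^ ℓ) * #FullRank⊗ ℓ 0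
      no-new-rank : sumMap (allMats b ℓ) (λ C → (q ^ b ∸ q ^ rank (Y ⊗ C) * #ker Y) * (δℕ (rank C) ℓ * 0)) ≡ 0
      no-new-rank = trans (sumMap-cong (allMats b ℓ) (λ C →
                                   trans (cong ((q ^ b ∸ q ^ rank (Y ⊗ C) * #ker Y) *_) (ℕₚ.*-zeroʳ (δℕ (rank C) ℓ)))
                                         (ℕₚ.*-zeroʳ (q ^ b ∸ q ^ rank (Y ⊗ C) * #ker Y))))
                          (sumMap-zero (allMats b ℓ))

    #FullRank⊗-∷ᶜ-suc : ∀ ℓ r → #FullRank⊗ (suc ℓ) (suc r)
      ≡ (q ^ suc r * #ker Y ∸ q ^ ℓ) * #FullRank⊗ ℓ (suc r) + (q ^ b ∸ q ^ r * #ker Y) * #FullRank⊗ ℓ r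
    #FullRank⊗-∷ᶜ-suc ℓ r = trans (#FullRank⊗-∷ᶜ ℓ (suc r)) (cong (leading +_) (begin
      sumMap (allMats b ℓ) (λ C → (q ^ b ∸ q ^ rank (Y ⊗ C) * #ker Y) * fullWithRank r C)
        ≡⟨ sumMap-cong (allMats b ℓ) (λ C → δℕ²*-subst (λ _ ρ → q ^ b ∸ q ^ ρ * #ker Y) (rank C) ℓ (rank (Y ⊗ C)) r) ⟩
      sumMap (allMats b ℓ) (λ C → (q ^ b ∸ q ^ r * #ker Y) * fullWithRank r C)
        ≡⟨ sumMap-*ˡ (allMats b ℓ) (q ^ b ∸ q ^ r * #ker Y) (fullWithRank r) ⟩
      (q ^ b ∸ q ^ r * #ker Y) * #FullRank⊗ ℓ r ∎))
      where
      open ≡-Reasoning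
      leading : ℕ
      leading = (q ^ suc r * #ker Y ∸ q ^ ℓ) * #FullRank⊗ ℓ (suc r)

    #FullRank⊗-no-cols : ∀ r → #FullRank⊗ 0 r ≡ δℕ 0 r
    #FullRank⊗-no-cols r = sumMap-allMats-no-cols b _ (λ C →
      trans (cong₂ (λ ρ₁ ρ₂ → δℕ ρ₁ 0 * δℕ ρ₂ r) (ℕₚ.n≤0⇒n≡0 (rank≤cols C)) (ℕₚ.n≤0⇒n≡0 (rank≤cols (Y ⊗ C))))
            (ℕₚ.+-identityʳ (δℕ 0 r)))

    private
      s d : ℕ
      s = rank Y
      d = b ∸ rank Y

      #ker≡q^d : #ker Y ≡ q ^ d
      #ker≡q^d = #ker≡q^[cols∸rank] Y

      q^b∸q^r*q^d : ∀ {r} → q ^ b ∸ q ^ r * q ^ d ≡ (q ^ s ∸ q ^ r) * q ^ d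
      q^b∸q^r*q^d {r} = sym (trans (ℕₚ.*-distribʳ-∸ (q ^ d) (q ^ s) (q ^ r))
        (cong (_∸ q ^ r * q ^ d) (trans (sym (ℕₚ.^-distribˡ-+-* q s d)) (cong (q ^_) (ℕₚ.m+[n∸m]≡n (rank≤cols Y))))))

      leading-term : ∀ ℓ r → (q ^ r * q ^ d ∸ q ^ ℓ) * (#Rank s ℓ r * #frames d (ℓ ∸ r) * q ^ (d * r))
                             ≡ #Rank s ℓ r * q ^ r * #frames d (suc ℓ ∸ r) * q ^ (d * r)
      leading-term ℓ r with ℕₚ.≤-<-connex r ℓ
      ... | inj₂ ℓ<r rewrite #Rank-cols< s ℓ r ℓ<r = ℕₚ.*-zeroʳ (q ^ r * q ^ d ∸ q ^ ℓ)
      ... | inj₁ r≤ℓ = begin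
        (q ^ r * q ^ d ∸ q ^ ℓ) * (G * N * E)
          ≡⟨ cong (_* (G * N * E)) q^r*q^d∸q^ℓ ⟩
        q ^ r * (q ^ d ∸ q ^ (ℓ ∸ r)) * (G * N * E)
          ≡⟨ rearrange (q ^ r) (q ^ d ∸ q ^ (ℓ ∸ r)) G N E ⟩
        G * q ^ r * #frames d (suc (ℓ ∸ r)) * E
          ≡⟨ cong (λ k → G * q ^ r * #frames d k * E) (ℕₚ.+-∸-assoc 1 r≤ℓ) ⟨
        G * q ^ r * #frames d (suc ℓ ∸ r) * E ∎
        where
        open ≡-Reasoning
        G N E : ℕ
        G = #Rank s ℓ r
        N = #frames d (ℓ ∸ r)
        E = q ^ (d * r)
        rearrange : ∀ Q A G N E → Q * A * (G * N * E) ≡ G * Q * (N * A) * E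
        rearrange = solve-∀
        q^r*q^d∸q^ℓ : q ^ r * q ^ d ∸ q ^ ℓ ≡ q ^ r * (q ^ d ∸ q ^ (ℓ ∸ r))
        q^r*q^d∸q^ℓ = sym (trans (ℕₚ.*-distribˡ-∸ (q ^ r) (q ^ d) (q ^ (ℓ ∸ r)))
          (cong (q ^ r * q ^ d ∸_) (trans (sym (ℕₚ.^-distribˡ-+-* q r (ℓ ∸ r))) (cong (q ^_) (ℕₚ.m+[n∸m]≡n r≤ℓ)))))

    #FullRank⊗-closed : ∀ ℓ r → #FullRank⊗ ℓ r ≡ #Rank (rank Y) ℓ r * #frames (b ∸ rank Y) (ℓ ∸ r) * q ^ ((b ∸ rank Y) * r)
    #FullRank⊗-closed zero r = begin
      #FullRank⊗ 0 r
        ≡⟨ #FullRank⊗-no-cols r ⟩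
      δℕ 0 r
        ≡⟨ vanishes-unless-zero r ⟩
      δℕ 0 r * #frames d (0 ∸ r) * q ^ (d * r)
        ≡⟨ cong (λ z → z * #frames d (0 ∸ r) * q ^ (d * r)) (#Rank-no-cols s r) ⟨
      #Rank s 0 r * #frames d (0 ∸ r) * q ^ (d * r) ∎
      where
      open ≡-Reasoning
      vanishes-unless-zero : ∀ r → δℕ 0 r ≡ δℕ 0 r * #frames d (0 ∸ r) * q ^ (d * r)
      vanishes-unless-zero zero    = sym (cong (λ e → 1 * 1 * q ^ e) (ℕₚ.*-zeroʳ d))
      vanishes-unless-zero (suc r) = refl
    #FullRank⊗-closed (suc ℓ) zero = begin
      #FullRank⊗ (suc ℓ) 0
        ≡⟨ #FullRank⊗-∷ᶜ-zero ℓ ⟩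
      (q ^ 0 * #ker Y ∸ q ^ ℓ) * #FullRank⊗ ℓ 0
        ≡⟨ cong₂ (λ κ f → (q ^ 0 * κ ∸ q ^ ℓ) * f) #ker≡q^d (#FullRank⊗-closed ℓ 0) ⟩
      (q ^ 0 * q ^ d ∸ q ^ ℓ) * (#Rank s ℓ 0 * #frames d ℓ * q ^ (d * 0))
        ≡⟨ leading-term ℓ 0 ⟩
      #Rank s ℓ 0 * q ^ 0 * #frames d (suc ℓ) * q ^ (d * 0)
        ≡⟨ cong (λ g → g * #frames d (suc ℓ) * q ^ (d * 0)) (trans (ℕₚ.*-identityʳ _) (sym (#Rank-∷ᶜ-zero s ℓ))) ⟩
      #Rank s (suc ℓ) 0 * #frames d (suc ℓ) * q ^ (d * 0) ∎
      where open ≡-Reasoning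
    #FullRank⊗-closed (suc ℓ) (suc r) = begin
      #FullRank⊗ (suc ℓ) (suc r)
        ≡⟨ #FullRank⊗-∷ᶜ-suc ℓ r ⟩
      (q ^ suc r * #ker Y ∸ q ^ ℓ) * #FullRank⊗ ℓ (suc r) + (q ^ b ∸ q ^ r * #ker Y) * #FullRank⊗ ℓ r
        ≡⟨ cong₂ _+_ (cong₂ (λ κ f → (q ^ suc r * κ ∸ q ^ ℓ) * f) #ker≡q^d (#FullRank⊗-closed ℓ (suc r)))
                     (cong₂ (λ κ f → (q ^ b ∸ q ^ r * κ) * f) #ker≡q^d (#FullRank⊗-closed ℓ r)) ⟩
      (q ^ suc r * q ^ d ∸ q ^ ℓ) * (#Rank s ℓ (suc r) * #frames d (ℓ ∸ suc r) * q ^ (d * suc r))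
        + (q ^ b ∸ q ^ r * q ^ d) * (#Rank s ℓ r * #frames d (ℓ ∸ r) * q ^ (d * r))
        ≡⟨ cong₂ _+_ (leading-term ℓ (suc r)) (cong (_* (#Rank s ℓ r * #frames d (ℓ ∸ r) * q ^ (d * r))) (q^b∸q^r*q^d {r})) ⟩
      #Rank s ℓ (suc r) * q ^ suc r * #frames d (ℓ ∸ r) * q ^ (d * suc r)
        + (q ^ s ∸ q ^ r) * q ^ d * (#Rank s ℓ r * #frames d (ℓ ∸ r) * q ^ (d * r))
        ≡⟨ cong (#Rank s ℓ (suc r) * q ^ suc r * #frames d (ℓ ∸ r) * q ^ (d * suc r) +_)
                (trans (rearrange (q ^ s ∸ q ^ r) (q ^ d) (#Rank s ℓ r) (#frames d (ℓ ∸ r)) (q ^ (d * r)))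
                       (cong (#Rank s ℓ r * (q ^ s ∸ q ^ r) * #frames d (ℓ ∸ r) *_) q^d*q^dr≡q^d[1+r])) ⟩
      #Rank s ℓ (suc r) * q ^ suc r * #frames d (ℓ ∸ r) * q ^ (d * suc r)
        + #Rank s ℓ r * (q ^ s ∸ q ^ r) * #frames d (ℓ ∸ r) * q ^ (d * suc r)
        ≡⟨ factor (#Rank s ℓ (suc r) * q ^ suc r) (#Rank s ℓ r * (q ^ s ∸ q ^ r)) (#frames d (ℓ ∸ r)) (q ^ (d * suc r)) ⟩
      (#Rank s ℓ (suc r) * q ^ suc r + #Rank s ℓ r * (q ^ s ∸ q ^ r)) * #frames d (ℓ ∸ r) * q ^ (d * suc r)
        ≡⟨ cong (λ g → g * #frames d (ℓ ∸ r) * q ^ (d * suc r)) (#Rank-∷ᶜ-suc s ℓ r) ⟨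
      #Rank s (suc ℓ) (suc r) * #frames d (ℓ ∸ r) * q ^ (d * suc r) ∎
      where
      open ≡-Reasoning
      rearrange : ∀ S D G N E → S * D * (G * N * E) ≡ G * S * N * (D * E)
      rearrange = solve-∀
      factor : ∀ A B N E → A * N * E + B * N * E ≡ (A + B) * N * E
      factor = solve-∀
      q^d*q^dr≡q^d[1+r] : q ^ d * q ^ (d * r) ≡ q ^ (d * suc r)
      q^d*q^dr≡q^d[1+r] = trans (sym (ℕₚ.^-distribˡ-+-* q d (d * r))) (cong (q ^_) (sym (ℕₚ.*-suc d r)))

-- The three probabilities

module Probabilities (K : FiniteField) where
  open RankCounts K public
  open FF K public using (Pairs; ratioFactor)

  ⟦isZeroMatᵇ⟧≡δℕ : ∀ {a b} (Z : Mat a b) → ⟦ isZeroMatᵇ Z ⟧ ≡ δℕ (rank Z) 0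
  ⟦isZeroMatᵇ⟧≡δℕ Z = cong ⟦_⟧ (T⇔⇒≡does
    (mk⇔ (from (rank≡0⇔zero Z) ∘ to (T-isZeroMatᵇ Z))
         (from (T-isZeroMatᵇ Z) ∘ to (rank≡0⇔zero Z)))
    (rank Z ℕₚ.≟ 0))

  #FullRank⊗-rank-zero : ∀ {a b} (Y : Mat a b) ℓ → #FullRank⊗ Y ℓ 0 ≡ #frames (b ∸ rank Y) ℓ
  #FullRank⊗-rank-zero {b = b} Y ℓ = begin
    #FullRank⊗ Y ℓ 0
      ≡⟨ #FullRank⊗-closed Y ℓ 0 ⟩
    #Rank (rank Y) ℓ 0 * #frames (b ∸ rank Y) ℓ * q ^ ((b ∸ rank Y) * 0)
      ≡⟨ cong₂ (λ g e → g * #frames (b ∸ rank Y) ℓ * q ^ e) (#Rank-rank-zero (rank Y) ℓ) (ℕₚ.*-zeroʳ (b ∸ rank Y)) ⟩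
    1 * #frames (b ∸ rank Y) ℓ * 1
      ≡⟨ trans (ℕₚ.*-identityʳ _) (ℕₚ.*-identityˡ _) ⟩
    #frames (b ∸ rank Y) ℓ ∎
    where open ≡-Reasoning

  #FullRank⊗-ᵀ : ∀ {a b} (Y : Mat a b) ℓ r →
    sumMap (allMats ℓ a) (λ A → δℕ (rank A) ℓ * δℕ (rank (A ⊗ Y)) r) ≡ #FullRank⊗ (Y ᵀ) ℓ r
  #FullRank⊗-ᵀ {a} Y ℓ r = trans (sumMap-ᵀ ℓ a _ congruent) (sumMap-cong (allMats a ℓ) transposed)
    where
    congruent : Congruent _≋_ _≡_ (λ (A : Mat ℓ a) → δℕ (rank A) ℓ * δℕ (rank (A ⊗ Y)) r)
    congruent A≋A′ = cong₂ (λ ρ₁ ρ₂ → δℕ ρ₁ ℓ * δℕ ρ₂ r) (rank-cong A≋A′) (rank-cong (⊗-cong {B = Y} A≋A′ (λ _ _ → refl)))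
    transposed : ∀ C → δℕ (rank (C ᵀ)) ℓ * δℕ (rank (C ᵀ ⊗ Y)) r ≡ δℕ (rank C) ℓ * δℕ (rank (Y ᵀ ⊗ C)) r
    transposed C = cong₂ (λ ρ₁ ρ₂ → δℕ ρ₁ ℓ * δℕ ρ₂ r) (rank-ᵀ C) (trans (sym (rank-ᵀ (C ᵀ ⊗ Y))) (rank-cong (ᵀ-⊗ (C ᵀ) Y)))

  #Rank-full-cols : ∀ a b → #Rank a b b ≡ #frames a b
  #Rank-full-cols a b = begin
    #Rank a b b
      ≡⟨ #Rank≡sumMap a b b ⟩
    sumMap (allMats a b) (λ B → δℕ (rank B) b)
      ≡⟨ sumMap-cong (allMats a b) (λ B → sym (trans (cong (δℕ (rank B) b *_) (Y₀⊗B-rank-zero B)) (ℕₚ.*-identityʳ _))) ⟩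
    #FullRank⊗ Y₀ b 0
      ≡⟨ #FullRank⊗-rank-zero Y₀ b ⟩
    #frames (a ∸ rank Y₀) b
      ≡⟨ cong (λ ρ → #frames (a ∸ ρ) b) (ℕₚ.n≤0⇒n≡0 (rank≤rows Y₀)) ⟩
    #frames a b ∎
    where
    open ≡-Reasoning
    Y₀ : Mat 0 a
    Y₀ ()
    Y₀⊗B-rank-zero : ∀ B → δℕ (rank (Y₀ ⊗ B)) 0 ≡ 1
    Y₀⊗B-rank-zero B = δℕ-yes (ℕₚ.n≤0⇒n≡0 (rank≤rows (Y₀ ⊗ B)))

  #Rank-full-rows : ∀ a b → #Rank a b a ≡ #frames b a
  #Rank-full-rows a b = trans (#Rank-ᵀ a b a) (#Rank-full-cols b a)

  0<q^d∸q^k : ∀ {d k} → k < d → 0 < q ^ d ∸ q ^ k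
  0<q^d∸q^k k<d = ℕₚ.m<n⇒0<n∸m (ℕₚ.^-monoʳ-< q 2≤q k<d)

  #frames-positive : ∀ {d k} → k ≤ d → 0 < #frames d k
  #frames-positive {k = zero}  _   = s≤s z≤n
  #frames-positive {k = suc k} k<d = ℕₚ.*-mono-≤ (#frames-positive (ℕₚ.<⇒≤ k<d)) (0<q^d∸q^k k<d)

  #frames-vanishes : ∀ {d k} → d < k → #frames d k ≡ 0
  #frames-vanishes {d} {suc k} d<1+k with ℕₚ.m≤n⇒m<n∨m≡n (ℕₚ.≤-pred d<1+k)
  ... | inj₁ d<k  = cong (_* (q ^ d ∸ q ^ k)) (#frames-vanishes d<k)
  ... | inj₂ refl = trans (cong (#frames d d *_) (ℕₚ.n∸n≡0 (q ^ d))) (ℕₚ.*-zeroʳ (#frames d d))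

  prodQ-ratioFactor : ∀ e d k → k ≤ d → prodQ k (ratioFactor e d) ≡ frac (ℤ.+ #frames e k) (#frames d k)
  prodQ-ratioFactor e d zero    _   = refl
  prodQ-ratioFactor e d (suc k) k<d with ℕₚ.≤-<-connex k e
  ... | inj₁ k≤e = begin
    prodQ k (ratioFactor e d) ℚ.* ratioFactor e d k
      ≡⟨ cong₂ ℚ._*_ (prodQ-ratioFactor e d k (ℕₚ.<⇒≤ k<d)) (cong (λ z → frac z (q ^ d ∸ q ^ k)) numerator) ⟩
    frac (ℤ.+ #frames e k) (#frames d k) ℚ.* frac (ℤ.+ (q ^ e ∸ q ^ k)) (q ^ d ∸ q ^ k)
      ≡⟨ frac-*ℕ _ _ _ _ (#frames-positive (ℕₚ.<⇒≤ k<d)) (0<q^d∸q^k k<d) ⟩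
    frac (ℤ.+ #frames e (suc k)) (#frames d (suc k)) ∎
    where
    open ≡-Reasoning
    numerator : ℤ.+ (q ^ e) ℤ.- ℤ.+ (q ^ k) ≡ ℤ.+ (q ^ e ∸ q ^ k)
    numerator = trans (ℤₚ.m-n≡m⊖n (q ^ e) (q ^ k)) (ℤₚ.⊖-≥ (ℕₚ.^-monoʳ-≤ q k≤e))
  ... | inj₂ e<k = begin
    prodQ k (ratioFactor e d) ℚ.* ratioFactor e d k
      ≡⟨ cong (ℚ._* ratioFactor e d k) (prodQ-ratioFactor e d k (ℕₚ.<⇒≤ k<d)) ⟩
    frac (ℤ.+ #frames e k) (#frames d k) ℚ.* ratioFactor e d k
      ≡⟨ cong (λ z → frac (ℤ.+ z) (#frames d k) ℚ.* ratioFactor e d k) (#frames-vanishes e<k) ⟩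
    frac (ℤ.+ 0) (#frames d k) ℚ.* ratioFactor e d k
      ≡⟨ zero-numerator (#frames d k) (q ^ d ∸ q ^ k) (#frames-positive (ℕₚ.<⇒≤ k<d)) (0<q^d∸q^k k<d) ⟩
    frac (ℤ.+ 0) (#frames d (suc k))
      ≡⟨ cong (λ z → frac (ℤ.+ z) (#frames d (suc k))) (cong (_* (q ^ e ∸ q ^ k)) (#frames-vanishes e<k)) ⟨
    frac (ℤ.+ #frames e (suc k)) (#frames d (suc k)) ∎
    where
    open ≡-Reasoning
    zero-numerator : ∀ y y′ → 0 < y → 0 < y′ →
                     frac (ℤ.+ 0) y ℚ.* frac (ℤ.+ (q ^ e) ℤ.- ℤ.+ (q ^ k)) y′ ≡ frac (ℤ.+ 0) (y * y′)
    zero-numerator (suc y) (suc y′) _ _ = frac-* (ℤ.+ 0) (ℤ.+ (q ^ e) ℤ.- ℤ.+ (q ^ k)) y y′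

  module _ {ℓ m m′ n} (M : Mat m m′) (ℓ≤m : ℓ ≤ m) (n≤m′ : n ≤ m′) where
    private
      #A #B : ℕ
      #A = #Rank ℓ m ℓ
      #B = #Rank m′ n n

      0<#A : 0 < #A
      0<#A = subst (0 <_) (sym (#Rank-full-rows ℓ m)) (#frames-positive ℓ≤m)

      0<#B : 0 < #B
      0<#B = subst (0 <_) (sym (#Rank-full-cols m′ n)) (#frames-positive n≤m′)

      #favourable : (Mat ℓ m × Mat m′ n → Bool) → ℕ
      #favourable E =
        sumMap (allMats ℓ m) (λ A → δℕ (rank A) ℓ * sumMap (allMats m′ n) (λ B → δℕ (rank B) n * ⟦ E (A , B) ⟧))

      prob-Pairs : ∀ E → prob (Pairs ℓ m m′ n) E ≡ frac (ℤ.+ #favourable E) (#A * #B)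
      prob-Pairs = prob-cartesianProduct (allMats ℓ m) (allMats m′ n) (λ A → rank A ℕ.≡ᵇ ℓ) (λ B → rank B ℕ.≡ᵇ n)

      #annihilating-B : ∀ {a} (Y : Mat a m′) →
        sumMap (allMats m′ n) (λ B → δℕ (rank B) n * ⟦ isZeroMatᵇ (Y ⊗ B) ⟧) ≡ #frames (m′ ∸ rank Y) n
      #annihilating-B Y = trans (sumMap-cong (allMats m′ n) (λ B → cong (δℕ (rank B) n *_) (⟦isZeroMatᵇ⟧≡δℕ (Y ⊗ B))))
                                (#FullRank⊗-rank-zero Y n)

      #A-of-rank : ℕ → ℕ
      #A-of-rank r = #Rank ℓ (rank M) r * #Rank (ℓ ∸ r) (m ∸ rank M) (ℓ ∸ r) * q ^ ((m ∸ rank M) * r)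

      sumMap≡#A-of-rank : ∀ r → sumMap (allMats ℓ m) (λ A → δℕ (rank A) ℓ * δℕ (rank (A ⊗ M)) r) ≡ #A-of-rank r
      sumMap≡#A-of-rank r = begin
        sumMap (allMats ℓ m) (λ A → δℕ (rank A) ℓ * δℕ (rank (A ⊗ M)) r)
          ≡⟨ #FullRank⊗-ᵀ M ℓ r ⟩
        #FullRank⊗ (M ᵀ) ℓ r
          ≡⟨ #FullRank⊗-closed (M ᵀ) ℓ r ⟩
        #Rank (rank (M ᵀ)) ℓ r * #frames (m ∸ rank (M ᵀ)) (ℓ ∸ r) * q ^ ((m ∸ rank (M ᵀ)) * r)
          ≡⟨ cong (λ ρ → #Rank ρ ℓ r * #frames (m ∸ ρ) (ℓ ∸ r) * q ^ ((m ∸ ρ) * r)) (rank-ᵀ M) ⟩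
        #Rank (rank M) ℓ r * #frames (m ∸ rank M) (ℓ ∸ r) * q ^ ((m ∸ rank M) * r)
          ≡⟨ cong₂ (λ g f → g * f * q ^ ((m ∸ rank M) * r))
                   (#Rank-ᵀ (rank M) ℓ r) (sym (#Rank-full-rows (ℓ ∸ r) (m ∸ rank M))) ⟩
        #A-of-rank r ∎
        where open ≡-Reasoning

    prob[AM≡0] : prob (Pairs ℓ m m′ n) (λ (A , B) → isZeroMatᵇ (A ⊗ M)) ≡ prodQ ℓ (ratioFactor (m ∸ rank M) m)
    prob[AM≡0] = begin
      prob (Pairs ℓ m m′ n) E                             ≡⟨ prob-Pairs E ⟩
      frac (ℤ.+ #favourable E) (#A * #B)                  ≡⟨ cong (λ k → frac (ℤ.+ k) (#A * #B)) favourable ⟩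
      frac (ℤ.+ (#frames (m ∸ rank M) ℓ * #B)) (#A * #B)  ≡⟨ frac-cancelʳ _ _ _ 0<#A 0<#B ⟩
      frac (ℤ.+ #frames (m ∸ rank M) ℓ) #A                ≡⟨ cong (frac (ℤ.+ #frames (m ∸ rank M) ℓ)) (#Rank-full-rows ℓ m) ⟩
      frac (ℤ.+ #frames (m ∸ rank M) ℓ) (#frames m ℓ)     ≡⟨ prodQ-ratioFactor (m ∸ rank M) m ℓ ℓ≤m ⟨
      prodQ ℓ (ratioFactor (m ∸ rank M) m)                ∎
      where
      open ≡-Reasoning
      E : Mat ℓ m × Mat m′ n → Bool
      E (A , B) = isZeroMatᵇ (A ⊗ M)
      favourable : #favourable E ≡ #frames (m ∸ rank M) ℓ * #B
      favourable = begin
        #favourable E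
          ≡⟨ sumMap-cong (allMats ℓ m) (λ A → cong (δℕ (rank A) ℓ *_) (trans (sumMap-*ʳ (allMats m′ n) _ _)
                           (cong₂ _*_ (sym (#Rank≡sumMap m′ n n)) (⟦isZeroMatᵇ⟧≡δℕ (A ⊗ M))))) ⟩
        sumMap (allMats ℓ m) (λ A → δℕ (rank A) ℓ * (#B * δℕ (rank (A ⊗ M)) 0))
          ≡⟨ sumMap-cong (allMats ℓ m) (λ A → trans (ℕ*.x∙yz≈y∙xz (δℕ (rank A) ℓ) #B _) (ℕₚ.*-comm #B _)) ⟩
        sumMap (allMats ℓ m) (λ A → δℕ (rank A) ℓ * δℕ (rank (A ⊗ M)) 0 * #B)
          ≡⟨ sumMap-*ʳ (allMats ℓ m) #B _ ⟩
        sumMap (allMats ℓ m) (λ A → δℕ (rank A) ℓ * δℕ (rank (A ⊗ M)) 0) * #B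
          ≡⟨ cong (_* #B) (trans (#FullRank⊗-ᵀ M ℓ 0) (#FullRank⊗-rank-zero (M ᵀ) ℓ)) ⟩
        #frames (m ∸ rank (M ᵀ)) ℓ * #B
          ≡⟨ cong (λ ρ → #frames (m ∸ ρ) ℓ * #B) (rank-ᵀ M) ⟩
        #frames (m ∸ rank M) ℓ * #B ∎

    prob[MB≡0] : prob (Pairs ℓ m m′ n) (λ (A , B) → isZeroMatᵇ (M ⊗ B)) ≡ prodQ n (ratioFactor (m′ ∸ rank M) m′)
    prob[MB≡0] = begin
      prob (Pairs ℓ m m′ n) E                              ≡⟨ prob-Pairs E ⟩
      frac (ℤ.+ #favourable E) (#A * #B)                   ≡⟨ cong₂ (λ k d → frac (ℤ.+ k) d) favourable (ℕₚ.*-comm #A #B) ⟩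
      frac (ℤ.+ (#frames (m′ ∸ rank M) n * #A)) (#B * #A)  ≡⟨ frac-cancelʳ _ _ _ 0<#B 0<#A ⟩
      frac (ℤ.+ #frames (m′ ∸ rank M) n) #B                ≡⟨ cong (frac (ℤ.+ #frames (m′ ∸ rank M) n)) (#Rank-full-cols m′ n) ⟩
      frac (ℤ.+ #frames (m′ ∸ rank M) n) (#frames m′ n)    ≡⟨ prodQ-ratioFactor (m′ ∸ rank M) m′ n n≤m′ ⟨
      prodQ n (ratioFactor (m′ ∸ rank M) m′)               ∎
      where
      open ≡-Reasoning
      E : Mat ℓ m × Mat m′ n → Bool
      E (A , B) = isZeroMatᵇ (M ⊗ B)
      favourable : #favourable E ≡ #frames (m′ ∸ rank M) n * #A
      favourable = begin
        #favourable E
          ≡⟨ sumMap-*ʳ (allMats ℓ m) _ _ ⟩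
        sumMap (allMats ℓ m) (λ A → δℕ (rank A) ℓ) * sumMap (allMats m′ n) (λ B → δℕ (rank B) n * ⟦ isZeroMatᵇ (M ⊗ B) ⟧)
          ≡⟨ cong₂ _*_ (sym (#Rank≡sumMap ℓ m ℓ)) (#annihilating-B M) ⟩
        #A * #frames (m′ ∸ rank M) n
          ≡⟨ ℕₚ.*-comm #A _ ⟩
        #frames (m′ ∸ rank M) n * #A ∎

    prob[AMB≡0] : prob (Pairs ℓ m m′ n) (λ (A , B) → isZeroMatᵇ ((A ⊗ M) ⊗ B))
      ≡ sumQ≤ (ℓ ⊓ rank M) (λ r →
          frac (ℤ.+ (#Rank ℓ (rank M) r * #Rank (ℓ ∸ r) (m ∸ rank M) (ℓ ∸ r) * q ^ ((m ∸ rank M) * r))) (#Rank ℓ m ℓ)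
          ℚ.* prodQ n (ratioFactor (m′ ∸ r) m′))
    prob[AMB≡0] = begin
      prob (Pairs ℓ m m′ n) E
        ≡⟨ prob-Pairs E ⟩
      frac (ℤ.+ #favourable E) (#A * #B)
        ≡⟨ cong (λ k → frac (ℤ.+ k) (#A * #B)) favourable ⟩
      frac (ℤ.+ sumℕ≤ (ℓ ⊓ rank M) (λ r → #A-of-rank r * #frames (m′ ∸ r) n)) (#A * #B)
        ≡⟨ sumQ≤-frac (ℓ ⊓ rank M) _ (#A * #B) (ℕₚ.*-mono-≤ 0<#A 0<#B) ⟨
      sumQ≤ (ℓ ⊓ rank M) (λ r → frac (ℤ.+ (#A-of-rank r * #frames (m′ ∸ r) n)) (#A * #B))
        ≡⟨ sumQ≤-cong (ℓ ⊓ rank M) split ⟩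
      sumQ≤ (ℓ ⊓ rank M) (λ r → frac (ℤ.+ #A-of-rank r) #A ℚ.* prodQ n (ratioFactor (m′ ∸ r) m′)) ∎
      where
      open ≡-Reasoning
      E : Mat ℓ m × Mat m′ n → Bool
      E (A , B) = isZeroMatᵇ ((A ⊗ M) ⊗ B)
      split : ∀ r → frac (ℤ.+ (#A-of-rank r * #frames (m′ ∸ r) n)) (#A * #B)
                    ≡ frac (ℤ.+ #A-of-rank r) #A ℚ.* prodQ n (ratioFactor (m′ ∸ r) m′)
      split r = begin
        frac (ℤ.+ (#A-of-rank r * #frames (m′ ∸ r) n)) (#A * #B)
          ≡⟨ frac-*ℕ _ _ _ _ 0<#A 0<#B ⟨
        frac (ℤ.+ #A-of-rank r) #A ℚ.* frac (ℤ.+ #frames (m′ ∸ r) n) #B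
          ≡⟨ cong (λ d → frac (ℤ.+ #A-of-rank r) #A ℚ.* frac (ℤ.+ #frames (m′ ∸ r) n) d) (#Rank-full-cols m′ n) ⟩
        frac (ℤ.+ #A-of-rank r) #A ℚ.* frac (ℤ.+ #frames (m′ ∸ r) n) (#frames m′ n)
          ≡⟨ cong (frac (ℤ.+ #A-of-rank r) #A ℚ.*_) (prodQ-ratioFactor (m′ ∸ r) m′ n n≤m′) ⟨
        frac (ℤ.+ #A-of-rank r) #A ℚ.* prodQ n (ratioFactor (m′ ∸ r) m′) ∎
      vanishes : ∀ r → ℓ ⊓ rank M < r → #A-of-rank r * #frames (m′ ∸ r) n ≡ 0
      vanishes r ℓ⊓s<r =
        cong (λ g → g * #Rank (ℓ ∸ r) (m ∸ rank M) (ℓ ∸ r) * q ^ ((m ∸ rank M) * r) * #frames (m′ ∸ r) n) #Rank≡0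
        where
        #Rank≡0 : #Rank ℓ (rank M) r ≡ 0
        #Rank≡0 with ℕₚ.⊓-sel ℓ (rank M)
        ... | inj₁ ℓ⊓s≡ℓ = #Rank-rows< ℓ (rank M) r (subst (_< r) ℓ⊓s≡ℓ ℓ⊓s<r)
        ... | inj₂ ℓ⊓s≡s = #Rank-cols< ℓ (rank M) r (subst (_< r) ℓ⊓s≡s ℓ⊓s<r)
      favourable : #favourable E ≡ sumℕ≤ (ℓ ⊓ rank M) (λ r → #A-of-rank r * #frames (m′ ∸ r) n)
      favourable = begin
        #favourable E
          ≡⟨ sumMap-cong (allMats ℓ m) (λ A → cong (δℕ (rank A) ℓ *_) (#annihilating-B (A ⊗ M))) ⟩
        sumMap (allMats ℓ m) (λ A → δℕ (rank A) ℓ * #frames (m′ ∸ rank (A ⊗ M)) n)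
          ≡⟨ sumMap-cong (allMats ℓ m) (λ A →
               sumℕ≤-δℕ m′ (rank (A ⊗ M)) (λ r → δℕ (rank A) ℓ * #frames (m′ ∸ r) n) (rank≤cols (A ⊗ M))) ⟨
        sumMap (allMats ℓ m) (λ A → sumℕ≤ m′ (λ r → δℕ (rank (A ⊗ M)) r * (δℕ (rank A) ℓ * #frames (m′ ∸ r) n)))
          ≡⟨ sumMap-sumℕ≤ (allMats ℓ m) m′ _ ⟩
        sumℕ≤ m′ (λ r → sumMap (allMats ℓ m) (λ A → δℕ (rank (A ⊗ M)) r * (δℕ (rank A) ℓ * #frames (m′ ∸ r) n)))
          ≡⟨ sumℕ≤-cong m′ (λ r → trans
               (sumMap-cong (allMats ℓ m) (λ A → ℕ*.x∙yz≈yx∙z (δℕ (rank (A ⊗ M)) r) (δℕ (rank A) ℓ) _))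
               (trans (sumMap-*ʳ (allMats ℓ m) _ _) (cong (_* #frames (m′ ∸ r) n) (sumMap≡#A-of-rank r)))) ⟩
        sumℕ≤ m′ (λ r → #A-of-rank r * #frames (m′ ∸ r) n)
          ≡⟨ sumℕ≤-truncate m′ (ℓ ⊓ rank M) _ (ℕₚ.≤-trans (ℕₚ.m⊓n≤n ℓ (rank M)) (rank≤cols M)) vanishes ⟩
        sumℕ≤ (ℓ ⊓ rank M) (λ r → #A-of-rank r * #frames (m′ ∸ r) n) ∎

-- Opened only here: earlier, Data.Integer's +_ would make sections such as (x +_) ambiguous.
open import Data.Integer using (+_)

lemma3 : (K : FiniteField) → let open FF K in
    (ℓ m m' n s : ℕ) → s ≤ m ⊓ m' → ℓ ≤ m → n ≤ m' →
    (M : Mat m m') → rank M ≡ s →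
      (prob (Pairs ℓ m m' n) (λ { (A , B) → isZeroMatᵇ (A ⊗ M) })
         ≡ prodQ ℓ (ratioFactor (m ∸ s) m))
    × (prob (Pairs ℓ m m' n) (λ { (A , B) → isZeroMatᵇ (M ⊗ B) })
         ≡ prodQ n (ratioFactor (m' ∸ s) m'))
    × (prob (Pairs ℓ m m' n) (λ { (A , B) → isZeroMatᵇ ((A ⊗ M) ⊗ B) })
         ≡ sumQ≤ (ℓ ⊓ s) (λ r →
             frac (+ (#Rank ℓ s r ℕ.* #Rank (ℓ ∸ r) (m ∸ s) (ℓ ∸ r) ℕ.* q ^ ((m ∸ s) ℕ.* r)))
                  (#Rank ℓ m ℓ)
             ℚ.* prodQ n (ratioFactor (m' ∸ r) m')))
lemma3 K ℓ m m' n .(FF.rank K M) _ ℓ≤m n≤m' M refl =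
  prob[AM≡0] M ℓ≤m n≤m' , prob[MB≡0] M ℓ≤m n≤m' , prob[AMB≡0] M ℓ≤m n≤m'
  where open Probabilities K
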